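{- With the notation below: (i) If $\ell(\lambda_{\vec{v}})=f$, then $W_{D}^{\vec{v}}(\overline{\rho})=\emptyset$. (ii) If $\ell(\lambda_{\vec{v}})=d<f$, then $\#W_{D}^{\vec{v}}(\overline{\rho})=2^{f-d}$. (iii) Assume $\overline{\psi}=\overline{\psi}_{\vec{u},\vec{v}}\in W_{D}^{\vec{v}}(\overline{\rho})$ with $\vec{u}\in U_{\vec{v}}$. If there exist $\vec{u}',\vec{v}'$ such that $\overline{\Theta}([\overline\psi])_{\vec{u}'}=\sigma_{\vec{v}'}(\overline{\rho})$, then $\vec{v}\leq\vec{v}'$. In particular, if $W_{D}^{\vec{v}}(\overline{\rho})\cap W_{D}^{\vec{v}'}(\overline{\rho})\neq\emptyset$ then $\vec{v}=\vec{v}'$. (iv) $W_{D}(\overline{\rho})=\bigsqcup_{\vec{v}\in\{0,1\}^{\mathbb{Z}/f\mathbb{Z}}} W_{D}^{\vec{v}}(\overline{\rho})$. (v) $W_{D}^{\vec{v}}(\overline{\rho})=W_{D,\vec{v}}(\overline{\rho})\setminus\bigcup_{\vec{v}'<\vec{v}}W_{D,\vec{v}'}(\overline{\rho})$.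
   Context: $K$ is unramified of degree $f$ over $\mathbb{Q}_p$ with residue field $k$, $q=p^f$, $l$ the quadratic extension of $k$, $\mathbb{F}$ a sufficiently large finite field, $\overline{\iota}:l\hookrightarrow\mathbb{F}$ fixed and $\overline{\kappa}_0:k\hookrightarrow\mathbb{F}$ with $\overline{\iota}^{q+1}=\overline{\kappa}_0\circ\mathrm{Nm}_{l/k}$; $D$ is the quaternion division algebra over $K$ and $W_D(\overline{\rho})$ its set of quaternionic Serre weights (characters $\overline\psi:l^\times\to\mathbb{F}^\times$). $\overline{\rho}$ is generic reducible split: $\overline{\rho}|_{I_K}\cong\mathrm{diag}(\omega_f^{\sum_i p^i(r_i+1)},1)\otimes(\overline{\kappa}_0\circ\mathrm{res}\circ\mathrm{Art}_K^{ -1})$ with $0\le r_i\le p-3$, not all $r_i$ equal to $0$ or all equal to $p-3$. For $\vec{v}\in\{0,1\}^{\mathbb{Z}/f\mathbb{Z}}$, $\lambda_{\vec{v}}$ is the element of the Breuil–Paškūnas set $\mathcal{RD}(x_0,\dots,x_{f-1},x)$ with $\lambda_{\vec v,i}\in\{x_i,x_i+1\}$ if $v_i=0$ and $\in\{x-2-x_i,x-3-x_i\}$ if $v_i=1$; $\ell(\lambda_{\vec{v}})=\#\{i: v_i=1\}$; and $\sigma_{\vec{v}}(\overline{\rho})=\lambda_{\vec{v}}(r_0,\dots,r_{f-1},p)\otimes(\overline{\kappa}_0\circ\det^{e(\lambda_{\vec{v}})(r_0,\dots,r_{f-1},p)})$, these being exactly the $\mathrm{GL}_2$-Serre weights of $\overline\rho$.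 For a type I character $\overline\psi$ with Teichmüller lift $[\overline\psi]$, the Jordan–Hölder factors of the reduction of the cuspidal type $\Theta([\overline\psi])$ are $\overline{\Theta}([\overline\psi])_{\vec{u}}$, $\vec u\in\{0,1\}^{\mathbb{Z}/f\mathbb{Z}}$ (Diamond's parametrisation by subsets $J\subseteq\{0,\dots,f-1\}$). Given $\vec u,\vec v$, there is a unique $\overline\psi=:\overline{\psi}_{\vec{u},\vec{v}}$ with $\overline{\Theta}([\overline\psi])_{\vec{u}}=\sigma_{\vec{v}}(\overline{\rho})$, and $\overline\psi\in W_D(\overline\rho)$ iff such $\vec u,\vec v$ exist. Partial order: $\vec{v}\le\vec{v}'$ iff $v_i=1\Rightarrow v'_i=1$ for all $i$. $U_{\vec{v}}$ is the set of $\vec{u}\in\{0,1\}^{\mathbb{Z}/f\mathbb{Z}}$ such that: if $v_{f-1}=1$ then $u_{f-1}-u_0\equiv v_{f-1}-v_0+1\pmod 2$; and for $0<i\le f-1$, if $v_{i-1}=1$ then $u_{i-1}-u_i\equiv v_{i-1}-v_i\pmod 2$. Define $W_{D}^{\vec{v}}(\overline{\rho}):=\{\overline\psi:l^\times\to\mathbb{F}^\times\mid\exists\vec{u}\in U_{\vec{v}},\ \sigma_{\vec{v}}(\overline{\rho})=\overline{\Theta}([\overline{\psi}])_{\vec{u}}\}$ and $W_{D,\vec{v}}(\overline{\rho}):=\{\overline{\psi}_{\vec{u},\vec{v}}\mid \vec{u}\in\{0,1\}^{\mathbb{Z}/f\mathbb{Z}}\}$. -}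

module Defs where

-- Combinatorial model of the objects in Proposition 3.11 (quaternionic Serre
-- weights of a generic reducible split rho-bar).

open import Data.Nat as ℕ using (ℕ; zero; suc; NonZero)
open import Data.Nat.Properties using (m^n≢0)
open import Data.Nat.DivMod using (_/_; _%_)
open import Data.Integer as ℤ using (ℤ; +_; _≤_)
open import Data.Integer.Divisibility using (_∣_)
open import Data.Integer.DivMod using (_/ℕ_)
open import Data.Fin as Fin using (Fin; zero; suc; toℕ; fromℕ; inject₁)
open import Data.Bool using (Bool; true; false; if_then_else_)
open import Data.Product using (Σ; _×_; _,_)
open import Data.List using (List; length)
open import Data.List.Membership.Propositional using (_∈_)
open import Data.List.Relation.Unary.Unique.Propositional using (Unique)
open import Relation.Nullary using (¬_; does)
open import Relation.Binary.PropositionalEquality using (_≡_; _≢_)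

-- q = p^f with f = suc m
qOf : ℕ → ℕ → ℕ
qOf p m = p ℕ.^ suc m

Congℤ : ℤ → ℤ → ℕ → Set
Congℤ a b n = (+ n) ∣ (a ℤ.- b)

Σℤ : (n : ℕ) → (Fin n → ℤ) → ℤ
Σℤ zero    g = + 0
Σℤ (suc n) g = g zero ℤ.+ Σℤ n (λ i → g (suc i))

Σℕ : (n : ℕ) → (Fin n → ℕ) → ℕ
Σℕ zero    g = 0
Σℕ (suc n) g = g zero ℕ.+ Σℕ n (λ i → g (suc i))

-- elements of {0,1}^{ℤ/fℤ}, f = suc m; index i ∈ Fin (suc m) stands for i mod f
Bin : ℕ → Set
Bin m = Fin (suc m) → Fin 2

bit : Fin 2 → ℤ
bit b = + toℕ b

prev : ∀ {m} → Fin (suc m) → Fin (suc m)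
prev {m} zero = fromℕ m
prev (suc j)  = inject₁ j

lastI : ∀ m → Fin (suc m)
lastI m = fromℕ m

sel : {A : Set} → Fin 2 → A → A → A
sel zero    a b = a
sel (suc _) a b = b

-- ℓ(λ_v) = #{ i : v_i = 1 }
ℓ : ∀ {m} → Bin m → ℕ
ℓ {m} v = Σℕ (suc m) (λ i → toℕ (v i))

_≤ᵥ_ : ∀ {m} → Bin m → Bin m → Set
v ≤ᵥ v' = ∀ i → v i ≡ suc zero → v' i ≡ suc zero

_<ᵥ_ : ∀ {m} → Bin m → Bin m → Set
v' <ᵥ v = (v' ≤ᵥ v) × ¬ (∀ i → v' i ≡ v i)

-- Serre weights of GL_2(k):  Sym^{r_0} ⊗ ... ⊗ Sym^{r_{f-1}} ⊗ (κ̄_0 ∘ det)^e,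
-- recorded as (r, e); two such are isomorphic iff the r agree and
-- e agree modulo q - 1.

record Weight (m : ℕ) : Set where
  constructor wt
  field
    sym : Fin (suc m) → ℤ
    det : ℤ
open Weight public

SameWeight : (p m : ℕ) → Weight m → Weight m → Set
SameWeight p m σ τ =
  (∀ i → sym σ i ≡ sym τ i) × Congℤ (det σ) (det τ) (qOf p m ℕ.∸ 1)

-- GL_2-Serre weights of rho-bar (Breuil–Paškūnas).
-- λ_v ∈ RD(x_0,…,x_{f-1},x): λ_{v,i} ∈ {x_i, x_i+1} if v_i = 0 and
-- ∈ {x-2-x_i, x-3-x_i} if v_i = 1, the shifted value (x_i+1, resp. x-3-x_i)
-- being taken exactly when v_{i-1} = 1 (BP's condition defining RD,
-- with λ_{-1} := λ_{f-1}).

lam : (p m : ℕ) → (Fin (suc m) → ℕ) → Bin m → Fin (suc m) → ℤ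
lam p m r v i =
  sel (v i) ((+ r i) ℤ.+ bit (v (prev i)))
            ((+ p) ℤ.- (+ 2) ℤ.- (+ r i) ℤ.- bit (v (prev i)))

-- e(λ)(x_0,…,x_{f-1},x) evaluated at (r_0,…,r_{f-1},p):
-- ½ Σ p^i (r_i - λ_i)            if λ_{f-1} ∈ {x_{f-1}, x_{f-1}+1},
-- ½ (p^f - 1 + Σ p^i (r_i - λ_i)) otherwise.
eLam : (p m : ℕ) → (Fin (suc m) → ℕ) → Bin m → ℤ
eLam p m r v =
  (Σℤ (suc m) (λ i → (+ (p ℕ.^ toℕ i)) ℤ.* ((+ r i) ℤ.- lam p m r v i))
   ℤ.+ (+ (qOf p m ℕ.∸ 1)) ℤ.* bit (v (lastI m))) /ℕ 2

sigma : (p m : ℕ) → (Fin (suc m) → ℕ) → Bin m → Weight m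
sigma p m r v = wt (lam p m r v) (eLam p m r v)

-- Characters ψ̄ : l^× → F^×.  l^× is cyclic of order q²-1 and ῑ generates
-- its character group, so ψ̄ = ῑ^n for a unique n ∈ [0, q²-1).

Char : ℕ → ℕ → Set
Char p m = Fin (qOf p m ℕ.* qOf p m ℕ.∸ 1)

-- Jordan–Hölder factors of the reduction of the cuspidal type Θ([ψ̄])
-- (Diamond's parametrisation).  Write ψ̄ = ῑ^{(q+1)b + 1 + c} with
-- 0 ≤ c ≤ q, c = Σ c_i p^i; Θ is defined iff ψ̄ ≠ ψ̄^q iff c ≠ q.  For
-- u ∈ {0,1}^{ℤ/fℤ} put
--   s_i = (c_i - 1  if u_i = 0;  p - 2 - c_i  if u_i = 1) + δ_i,
--   δ_0 = [u_{f-1} ≠ u_0],  δ_i = [u_{i-1} = u_i]  (0 < i ≤ f-1),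
--   e   = b + ½ (1 + c - Σ p^i s_i + (q-1) u_{f-1}).
-- Θ̄([ψ̄])_u exists iff 0 ≤ s_i ≤ p-1 for all i, and then equals
-- Sym^s ⊗ (κ̄_0 ∘ det)^e.

module _ (p : ℕ) .{{_ : NonZero p}} (m : ℕ) (n : ℕ) (u : Bin m) where

  private
    q = qOf p m

  cPart : ℕ
  cPart = (n ℕ.+ q) % suc q

  bPart : ℤ
  bPart = (+ ((n ℕ.+ q) / suc q)) ℤ.- (+ 1)

  cDigit : Fin (suc m) → ℕ
  cDigit i = (cPart / (p ℕ.^ toℕ i)) {{m^n≢0 p (toℕ i)}} % p

  shift : Fin (suc m) → ℤ
  shift zero    = if does (u (lastI m) Fin.≟ u zero) then + 0 else + 1
  shift (suc j) = if does (u (inject₁ j) Fin.≟ u (suc j)) then + 1 else + 0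

  thetaSym : Fin (suc m) → ℤ
  thetaSym i = sel (u i) ((+ cDigit i) ℤ.- (+ 1))
                        ((+ p) ℤ.- (+ 2) ℤ.- (+ cDigit i))
               ℤ.+ shift i

  thetaDet : ℤ
  thetaDet = bPart ℤ.+
    (((+ 1) ℤ.+ (+ cPart)
      ℤ.- Σℤ (suc m) (λ i → (+ (p ℕ.^ toℕ i)) ℤ.* thetaSym i)
      ℤ.+ (+ (q ℕ.∸ 1)) ℤ.* bit (u (lastI m))) /ℕ 2)

-- ThetaIs p m ψ u σ  :⇔  Θ̄([ψ̄])_u is defined and  Θ̄([ψ̄])_u ≅ σ
ThetaIs : (p : ℕ) .{{_ : NonZero p}} (m : ℕ) → Char p m → Bin m → Weight m → Set
ThetaIs p m ψ u σ =
  (cPart p m (toℕ ψ) u ≢ qOf p m)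
  × (∀ i → (+ 0 ≤ thetaSym p m (toℕ ψ) u i) × (thetaSym p m (toℕ ψ) u i ≤ + (p ℕ.∸ 1)))
  × SameWeight p m (wt (thetaSym p m (toℕ ψ) u) (thetaDet p m (toℕ ψ) u)) σ

InU : ∀ m → Bin m → Bin m → Set
InU m v u =
  (v (lastI m) ≡ suc zero →
     Congℤ (bit (u (lastI m)) ℤ.- bit (u zero))
           (bit (v (lastI m)) ℤ.- bit (v zero) ℤ.+ + 1) 2)
  × (∀ (j : Fin m) → v (inject₁ j) ≡ suc zero →
     Congℤ (bit (u (inject₁ j)) ℤ.- bit (u (suc j)))
           (bit (v (inject₁ j)) ℤ.- bit (v (suc j))) 2)

WD : (p : ℕ) .{{_ : NonZero p}} (m : ℕ) → (Fin (suc m) → ℕ) → Char p m → Set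
WD p m r ψ = Σ (Bin m) λ u → Σ (Bin m) λ v → ThetaIs p m ψ u (sigma p m r v)

WDup : (p : ℕ) .{{_ : NonZero p}} (m : ℕ) → (Fin (suc m) → ℕ) → Bin m → Char p m → Set
WDup p m r v ψ = Σ (Bin m) λ u → InU m v u × ThetaIs p m ψ u (sigma p m r v)

-- W_{D,v}(ρ̄) = { ψ̄_{u,v} | u }, ψ̄_{u,v} being the (unique) ψ̄ with
-- Θ̄([ψ̄])_u = σ_v(ρ̄)
WDdown : (p : ℕ) .{{_ : NonZero p}} (m : ℕ) → (Fin (suc m) → ℕ) → Bin m → Char p m → Set
WDdown p m r v ψ = Σ (Bin m) λ u → ThetaIs p m ψ u (sigma p m r v)

HasSize : {A : Set} → (A → Set) → ℕ → Set
HasSize {A} P k =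
  Σ (List A) λ xs → Unique xs × (length xs ≡ k)
    × (∀ a → (P a → a ∈ xs) × (a ∈ xs → P a))

module Submission where

-- Write w = u ⊕ v.  If Θ̄([ψ̄])_u ≅ σ_v(ρ̄), every base-p digit of the c in ψ̄ = ῑ^{(q+1)b+1+c} is
-- forced by (u, v), and its parity records whether w jumps at that place (wᵢ ≠ w_{i-1} + [i = 0]);
-- the remaining part b of ψ̄ is pinned down by the determinant congruence modulo q - 1.  Hence
-- ψ̄_{u,v} = ψ̄_{u′,v′} exactly when w = w′ and v′ differs from v only at places i - 1 where w jumps.
-- On the other hand u ∈ U_v says that w does not jump after any 1 of v.  So among all (u′, v′)
-- giving the same ψ̄ exactly one v′ admits a u′ ∈ U_{v′}, namely v with the 1s followed by a jump
-- cleared, and it lies below all the others: this is (iii)-(v).  For (ii), the u ∈ U_v correspond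
-- to the w that are constant (up to the shift at 0) across each of the ℓ(v) steps after a 1 of v,
-- which leaves 2^{f-ℓ(v)} of them, and none at all when ℓ(v) = f, which is (i).

open import Defs
open import Data.Nat using (ℕ; suc; _+_; _<_; _≤_; _∸_; _^_; NonZero)
open import Data.Nat.Primality using (Prime)
open import Data.Fin using (Fin)
open import Data.Product using (Σ; _×_)
open import Relation.Nullary using (¬_)
open import Relation.Binary.PropositionalEquality using (_≡_)

open import Data.Nat as ℕ using (zero)
import Data.Nat.Properties as ℕP
import Data.Nat.DivMod as ℕD
open import Data.Nat.Divisibility using (divides-refl)
open import Data.Nat.Primality using (prime⇒¬composite; composite)
import Data.Nat.Tactic.RingSolver as ℕSolver
open import Data.Integer as ℤ using (ℤ; +_; -[1+_])
open import Data.Integer.Divisibility using (_∣_)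
import Data.Integer.Properties as ℤP
open import Algebra.Properties.AbelianGroup ℤP.+-0-abelianGroup using () renaming (∙-cancelˡ to +-cancelˡ)
import Data.Integer.DivMod as ℤD
import Data.Integer.Divisibility.Signed as ℤS
open import Data.Integer.Tactic.RingSolver using (solve-∀)
open import Data.Fin using (zero; suc; toℕ; fromℕ; inject₁; fromℕ<)
import Data.Fin.Properties as FinP
open import Data.Product using (_,_; proj₁; proj₂)
open import Data.Sum using (_⊎_; inj₁; inj₂; [_,_]′)
open import Data.Empty using (⊥; ⊥-elim)
open import Data.Bool using (if_then_else_)
open import Data.List using (List; []; _++_; [_]; map; length)
import Data.List.Properties as Listₚ
open import Data.List.Membership.Propositional using (_∈_)
open import Data.List.Relation.Unary.Unique.Propositional using (Unique)
open import Data.List.Membership.Propositional.Properties using (∈-map⁺; ∈-map⁻; ∈-++⁺ˡ; ∈-++⁺ʳ; ∈-++⁻)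
open import Data.List.Relation.Unary.All as All using (All)
open import Data.List.Relation.Unary.Any using (here)
open import Data.List.Relation.Unary.AllPairs as AllPairs using (AllPairs; []; _∷_)
import Data.List.Relation.Unary.AllPairs.Properties as AllPairsₚ
open import Function using (_∘_)
open import Relation.Nullary using (Dec; yes; no; does)
open import Relation.Nullary.Decidable using (True; toWitness; _→-dec_)
open import Relation.Binary.PropositionalEquality
  using (_≢_; _≗_; refl; trans; cong; cong₂; subst; subst₂; module ≡-Reasoning)
  renaming (sym to ≡-sym)

-- Bits

one : Fin 2
one = suc zero

infixl 6 _⊕_
_⊕_ : Fin 2 → Fin 2 → Fin 2
zero     ⊕ b        = b
suc zero ⊕ zero     = one
suc zero ⊕ suc zero = zero

record TruthTable (A : Set) : Set where
  field decideTable : Dec A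
open TruthTable {{...}}

instance
  bits-≡ : {a b : Fin 2} → TruthTable (a ≡ b)
  bits-≡ {a} {b} = record { decideTable = a FinP.≟ b }
  ints-≡ : {a b : ℤ} → TruthTable (a ≡ b)
  ints-≡ {a} {b} = record { decideTable = a ℤ.≟ b }
  bits-⊥ : TruthTable ⊥
  bits-⊥ = record { decideTable = no λ () }
  bits-→ : {A B : Set} {{_ : TruthTable A}} {{_ : TruthTable B}} → TruthTable (A → B)
  bits-→ = record { decideTable = decideTable →-dec decideTable }
  bits-∀ : {P : Fin 2 → Set} {{_ : ∀ {b} → TruthTable (P b)}} → TruthTable (∀ b → P b)
  bits-∀ {{t}} = record { decideTable = FinP.all? λ b → decideTable {{t {b}}} }

by-truth-table : {A : Set} {{_ : TruthTable A}} {_ : True (decideTable {A})} → A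
by-truth-table {_} {{_}} {holds} = toWitness holds

⊕-comm : ∀ a b → a ⊕ b ≡ b ⊕ a
⊕-comm = by-truth-table

⊕-self : ∀ a → a ⊕ a ≡ zero
⊕-self = by-truth-table

⊕-identityʳ : ∀ a → a ⊕ zero ≡ a
⊕-identityʳ = by-truth-table

⊕≡0⇒≡ : ∀ a b → a ⊕ b ≡ zero → a ≡ b
⊕≡0⇒≡ = by-truth-table

≡⇒⊕≡0 : ∀ a b → a ≡ b → a ⊕ b ≡ zero
≡⇒⊕≡0 = by-truth-table

⊕-cancelʳ : ∀ a b → a ⊕ b ⊕ b ≡ a
⊕-cancelʳ = by-truth-table

0≢1 : zero ≢ one
0≢1 ()

bit-cases : ∀ (a : Fin 2) → (a ≡ zero) ⊎ (a ≡ one)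
bit-cases zero     = inj₁ refl
bit-cases (suc zero) = inj₂ refl

sel-cases : ∀ {A : Set} (b : Fin 2) (x y : A) →
  ((b ≡ zero) × (sel b x y ≡ x)) ⊎ ((b ≡ one) × (sel b x y ≡ y))
sel-cases zero       x y = inj₁ (refl , refl)
sel-cases (suc zero) x y = inj₂ (refl , refl)

⊕-sum : (n : ℕ) → (Fin n → Fin 2) → Fin 2
⊕-sum zero    g = zero
⊕-sum (suc n) g = g zero ⊕ ⊕-sum n (λ i → g (suc i))

⊕-sum-cong : ∀ n {f g : Fin n → Fin 2} → (∀ i → f i ≡ g i) → ⊕-sum n f ≡ ⊕-sum n g
⊕-sum-cong zero    e = refl
⊕-sum-cong (suc n) e = cong₂ _⊕_ (e zero) (⊕-sum-cong n (λ i → e (suc i)))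

⊕-sum-telescope : ∀ m (g : Fin (suc m) → Fin 2) →
  ⊕-sum m (λ j → g (inject₁ j) ⊕ g (suc j)) ≡ g zero ⊕ g (fromℕ m)
⊕-sum-telescope zero    g = ≡-sym (⊕-self (g zero))
⊕-sum-telescope (suc m) g =
  trans (cong (g zero ⊕ g (suc zero) ⊕_) (⊕-sum-telescope m (λ i → g (suc i))))
        (collapse (g zero) (g (suc zero)) (g (suc (fromℕ m))))
  where
  collapse : ∀ a b c → a ⊕ b ⊕ (b ⊕ c) ≡ a ⊕ c
  collapse = by-truth-table

Σℕ-bits≤ : ∀ n (g : Fin n → Fin 2) → Σℕ n (λ i → toℕ (g i)) ≤ n
Σℕ-bits≤ zero    g = ℕ.z≤n
Σℕ-bits≤ (suc n) g with g zero
... | zero     = ℕP.m≤n⇒m≤1+n (Σℕ-bits≤ n (λ i → g (suc i)))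
... | suc zero = ℕ.s≤s (Σℕ-bits≤ n (λ i → g (suc i)))

Σℕ-bits≡n⇒all-one : ∀ n (g : Fin n → Fin 2) → Σℕ n (λ i → toℕ (g i)) ≡ n → ∀ i → g i ≡ one
Σℕ-bits≡n⇒all-one (suc n) g e i with g zero in g0
Σℕ-bits≡n⇒all-one (suc n) g e i | zero =
  ⊥-elim (ℕP.<-irrefl refl (ℕP.≤-trans (ℕ.s≤s (Σℕ-bits≤ n (λ i → g (suc i)))) (ℕP.≤-reflexive (≡-sym e))))
Σℕ-bits≡n⇒all-one (suc n) g e zero    | suc zero = g0
Σℕ-bits≡n⇒all-one (suc n) g e (suc i) | suc zero =
  Σℕ-bits≡n⇒all-one n (λ i → g (suc i)) (ℕP.suc-injective e) i

last-or-inject₁ : ∀ {m} (i : Fin (suc m)) → (i ≡ fromℕ m) ⊎ Σ (Fin m) (λ j → i ≡ inject₁ j)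
last-or-inject₁ {zero}  zero    = inj₁ refl
last-or-inject₁ {suc m} zero    = inj₂ (zero , refl)
last-or-inject₁ {suc m} (suc i) with last-or-inject₁ i
... | inj₁ e       = inj₁ (cong suc e)
... | inj₂ (j , e) = inj₂ (suc j , cong suc e)

next : ∀ {m} → Fin (suc m) → Fin (suc m)
next i with last-or-inject₁ i
... | inj₁ _       = zero
... | inj₂ (j , _) = suc j

prev-next : ∀ {m} (i : Fin (suc m)) → prev (next i) ≡ i
prev-next i with last-or-inject₁ i
... | inj₁ e       = ≡-sym e
... | inj₂ (j , e) = ≡-sym e

prev-injective : ∀ {m} (i j : Fin (suc m)) → prev i ≡ prev j → i ≡ j
prev-injective zero    zero    e = refl
prev-injective zero    (suc j) e = ⊥-elim (FinP.fromℕ≢inject₁ e)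
prev-injective (suc i) zero    e = ⊥-elim (FinP.fromℕ≢inject₁ (≡-sym e))
prev-injective (suc i) (suc j) e = cong suc (FinP.inject₁-injective e)

next-prev : ∀ {m} (i : Fin (suc m)) → next (prev i) ≡ i
next-prev i = prev-injective _ _ (prev-next (prev i))

constant-by-steps : ∀ {A : Set} m (g : Fin (suc m) → A) →
  (∀ (k : Fin m) → g (suc k) ≡ g (inject₁ k)) → ∀ i → g i ≡ g zero
constant-by-steps m       g step zero    = refl
constant-by-steps (suc m) g step (suc k) =
  trans (step k) (constant-by-steps m (λ i → g (inject₁ i)) (λ k → step (inject₁ k)) k)

-- Parity of integers

Parity : ℤ → Fin 2 → Set
Parity z b = Σ ℤ λ k → z ≡ bit b ℤ.+ k ℤ.* + 2

parity-bit : ∀ b → Parity (bit b) b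
parity-bit b = + 0 , plus-zero (bit b)
  where plus-zero : ∀ x → x ≡ x ℤ.+ + 0 ℤ.* + 2
        plus-zero = solve-∀

bit-+ : ∀ b d → Parity (bit b ℤ.+ bit d) (b ⊕ d)
bit-+ zero       zero       = + 0 , refl
bit-+ zero       (suc zero) = + 0 , refl
bit-+ (suc zero) zero       = + 0 , refl
bit-+ (suc zero) (suc zero) = + 1 , refl

parity-+ : ∀ {a c b d} → Parity a b → Parity c d → Parity (a ℤ.+ c) (b ⊕ d)
parity-+ {b = b} {d} (k , refl) (k′ , refl) with bit-+ b d
... | e , carry = e ℤ.+ (k ℤ.+ k′) , (begin
    (bit b ℤ.+ k ℤ.* + 2) ℤ.+ (bit d ℤ.+ k′ ℤ.* + 2)   ≡⟨ regroup (bit b) (bit d) k k′ ⟩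
    (bit b ℤ.+ bit d) ℤ.+ (k ℤ.+ k′) ℤ.* + 2           ≡⟨ cong (ℤ._+ (k ℤ.+ k′) ℤ.* + 2) carry ⟩
    (bit (b ⊕ d) ℤ.+ e ℤ.* + 2) ℤ.+ (k ℤ.+ k′) ℤ.* + 2 ≡⟨ collect (bit (b ⊕ d)) e k k′ ⟩
    bit (b ⊕ d) ℤ.+ (e ℤ.+ (k ℤ.+ k′)) ℤ.* + 2         ∎)
  where
  open ≡-Reasoning
  regroup : ∀ B D k k′ → (B ℤ.+ k ℤ.* + 2) ℤ.+ (D ℤ.+ k′ ℤ.* + 2) ≡ (B ℤ.+ D) ℤ.+ (k ℤ.+ k′) ℤ.* + 2
  regroup = solve-∀
  collect : ∀ X e k k′ → (X ℤ.+ e ℤ.* + 2) ℤ.+ (k ℤ.+ k′) ℤ.* + 2 ≡ X ℤ.+ (e ℤ.+ (k ℤ.+ k′)) ℤ.* + 2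
  collect = solve-∀

parity-neg : ∀ {a b} → Parity a b → Parity (ℤ.- a) b
parity-neg {b = b} (k , refl) = ℤ.- bit b ℤ.- k , negate (bit b) k
  where negate : ∀ B k → ℤ.- (B ℤ.+ k ℤ.* + 2) ≡ B ℤ.+ (ℤ.- B ℤ.- k) ℤ.* + 2
        negate = solve-∀

parity-- : ∀ {a c b d} → Parity a b → Parity c d → Parity (a ℤ.- c) (b ⊕ d)
parity-- pa pc = parity-+ pa (parity-neg pc)

parity-odd* : ∀ {a c d} → Parity a one → Parity c d → Parity (a ℤ.* c) d
parity-odd* {d = d} (k , refl) (k′ , refl) =
  k ℤ.* bit d ℤ.+ k′ ℤ.+ k ℤ.* k′ ℤ.* + 2 , expand (bit d) k k′
  where expand : ∀ D k k′ → (+ 1 ℤ.+ k ℤ.* + 2) ℤ.* (D ℤ.+ k′ ℤ.* + 2)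
                            ≡ D ℤ.+ (k ℤ.* D ℤ.+ k′ ℤ.+ k ℤ.* k′ ℤ.* + 2) ℤ.* + 2
        expand = solve-∀

parity-even* : ∀ {a} c → Parity a zero → Parity (a ℤ.* c) zero
parity-even* c (k , refl) = k ℤ.* c , expand k c
  where expand : ∀ k c → (+ 0 ℤ.+ k ℤ.* + 2) ℤ.* c ≡ + 0 ℤ.+ (k ℤ.* c) ℤ.* + 2
        expand = solve-∀

parity-two : Parity (+ 2) zero
parity-two = + 1 , refl

parity-exists : ∀ z → Σ (Fin 2) (Parity z)
parity-exists z = fromℕ< (ℤD.n%ℕd<d z 2) , z ℤ./ℕ 2 ,
  trans (ℤD.a≡a%ℕn+[a/ℕn]*n z 2)
        (cong (λ x → + x ℤ.+ (z ℤ./ℕ 2) ℤ.* + 2) (≡-sym (FinP.toℕ-fromℕ< (ℤD.n%ℕd<d z 2))))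

one≢double : ∀ j → + 1 ≢ j ℤ.* + 2
one≢double (+ zero)  ()
one≢double (+ suc n) ()
one≢double -[1+ n ]  ()

odd≢even : ∀ k l → + 1 ℤ.+ k ℤ.* + 2 ≢ + 0 ℤ.+ l ℤ.* + 2
odd≢even k l e = one≢double (l ℤ.- k) (trans (cancel k) (trans (cong (ℤ._- k ℤ.* + 2) e) (factor l k)))
  where
  cancel : ∀ k → + 1 ≡ (+ 1 ℤ.+ k ℤ.* + 2) ℤ.- k ℤ.* + 2
  cancel = solve-∀
  factor : ∀ l k → (+ 0 ℤ.+ l ℤ.* + 2) ℤ.- k ℤ.* + 2 ≡ (l ℤ.- k) ℤ.* + 2
  factor = solve-∀

parity-unique : ∀ {z b b′} → Parity z b → Parity z b′ → b ≡ b′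
parity-unique {b = zero}     {zero}     _ _ = refl
parity-unique {b = suc zero} {suc zero} _ _ = refl
parity-unique {b = zero}     {suc zero} (k , e) (k′ , e′) = ⊥-elim (odd≢even k′ k (trans (≡-sym e′) e))
parity-unique {b = suc zero} {zero}     (k , e) (k′ , e′) = ⊥-elim (odd≢even k k′ (trans (≡-sym e) e′))

Congℤ-witness : ∀ {a b n} → Congℤ a b n → Σ ℤ λ k → a ℤ.- b ≡ k ℤ.* + n
Congℤ-witness c with ℤS.∣ᵤ⇒∣ c
... | ℤS.divides k e = k , e

Congℤ-intro : ∀ {a b n} → (Σ ℤ λ k → a ℤ.- b ≡ k ℤ.* + n) → Congℤ a b n
Congℤ-intro (k , e) = ℤS.∣⇒∣ᵤ (ℤS.divides k e)

Congℤ₂⇒even : ∀ {a b} → Congℤ a b 2 → Parity (a ℤ.- b) zero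
Congℤ₂⇒even {a} {b} c with Congℤ-witness {a} {b} c
... | k , e = k , trans e (≡-sym (ℤP.+-identityˡ _))

even⇒Congℤ₂ : ∀ {a b} → Parity (a ℤ.- b) zero → Congℤ a b 2
even⇒Congℤ₂ {a} {b} (k , e) = Congℤ-intro {a} {b} (k , trans e (ℤP.+-identityˡ _))

Congℤ-sym : ∀ {a b n} → Congℤ a b n → Congℤ b a n
Congℤ-sym {a} {b} {n} a≡b =
  ℤS.∣⇒∣ᵤ (subst (ℤS._∣_ (+ n)) (negate a b) (ℤS.∣m⇒∣-m (ℤS.∣ᵤ⇒∣ {+ n} {a ℤ.- b} a≡b)))
  where negate : ∀ a b → ℤ.- (a ℤ.- b) ≡ b ℤ.- a
        negate = solve-∀

Congℤ-trans : ∀ {a b c n} → Congℤ a b n → Congℤ b c n → Congℤ a c n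
Congℤ-trans {a} {b} {c} {n} a≡b b≡c =
  ℤS.∣⇒∣ᵤ (subst (ℤS._∣_ (+ n)) (telescope a b c)
                 (ℤS.∣m∣n⇒∣m+n (ℤS.∣ᵤ⇒∣ {+ n} {a ℤ.- b} a≡b) (ℤS.∣ᵤ⇒∣ {+ n} {b ℤ.- c} b≡c)))
  where telescope : ∀ a b c → (a ℤ.- b) ℤ.+ (b ℤ.- c) ≡ a ℤ.- c
        telescope = solve-∀

multiple-too-far : ∀ {t t′ n} j → + t ℤ.- + t′ ≡ + suc j ℤ.* + n → 1 ≤ t′ → t ≤ n → ⊥
multiple-too-far {t} {t′} {n} j t-t′ 1≤t′ t≤n = ℕP.<⇒≱ (begin-strict
  n                  <⟨ ℕP.+-mono-≤ 1≤t′ (ℕP.m≤m+n n (j ℕ.* n)) ⟩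
  t′ + suc j ℕ.* n   ≡⟨ ℤP.+-injective t≡ ⟩
  t                  ∎) t≤n
  where
  open ℕP.≤-Reasoning
  move : ∀ a b → b ℤ.+ (a ℤ.- b) ≡ a
  move = solve-∀
  t≡ : + (t′ + suc j ℕ.* n) ≡ + t
  t≡ = trans (ℤP.pos-+ t′ (suc j ℕ.* n))
             (trans (cong (λ d → + t′ ℤ.+ d) (trans (ℤP.pos-* (suc j) n) (≡-sym t-t′))) (move (+ t) (+ t′)))

Congℤ-bounded-≡ : ∀ {t t′ n} → Congℤ (+ t) (+ t′) n → 1 ≤ t → t ≤ n → 1 ≤ t′ → t′ ≤ n → t ≡ t′
Congℤ-bounded-≡ {t} {t′} {n} t≡t′ 1≤t t≤n 1≤t′ t′≤n with Congℤ-witness {+ t} {+ t′} t≡t′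
... | + zero   , t-t′ = ℤP.+-injective (ℤP.i-j≡0⇒i≡j (+ t) (+ t′) t-t′)
... | + suc j  , t-t′ = ⊥-elim (multiple-too-far j t-t′ 1≤t′ t≤n)
... | -[1+ j ] , t-t′ = ⊥-elim (multiple-too-far j t′-t 1≤t t′≤n)
  where
  negate : ∀ a b → b ℤ.- a ≡ ℤ.- (a ℤ.- b)
  negate = solve-∀
  t′-t : + t′ ℤ.- + t ≡ + suc j ℤ.* + n
  t′-t = trans (negate (+ t) (+ t′)) (trans (cong ℤ.-_ t-t′) (ℤP.neg-distribˡ-* -[1+ j ] (+ n)))

half-double : ∀ {z} → Parity z zero → z ≡ z ℤ./ℕ 2 ℤ.+ z ℤ./ℕ 2
half-double {z} even = begin
  z                                  ≡⟨ ℤD.a≡a%ℕn+[a/ℕn]*n z 2 ⟩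
  + (z ℤ.%ℕ 2) ℤ.+ (z ℤ./ℕ 2) ℤ.* + 2 ≡⟨ cong (λ r → + r ℤ.+ (z ℤ./ℕ 2) ℤ.* + 2) remainder-zero ⟩
  + 0 ℤ.+ (z ℤ./ℕ 2) ℤ.* + 2         ≡⟨ double (z ℤ./ℕ 2) ⟩
  z ℤ./ℕ 2 ℤ.+ z ℤ./ℕ 2              ∎
  where
  open ≡-Reasoning
  remainder-zero : z ℤ.%ℕ 2 ≡ 0
  remainder-zero = trans (≡-sym (FinP.toℕ-fromℕ< (ℤD.n%ℕd<d z 2)))
                         (cong toℕ (parity-unique (proj₂ (parity-exists z)) even))
  double : ∀ h → + 0 ℤ.+ h ℤ.* + 2 ≡ h ℤ.+ h
  double = solve-∀

Σℤ-cong : ∀ n {f g : Fin n → ℤ} → (∀ i → f i ≡ g i) → Σℤ n f ≡ Σℤ n g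
Σℤ-cong zero    e = refl
Σℤ-cong (suc n) e = cong₂ ℤ._+_ (e zero) (Σℤ-cong n (λ i → e (suc i)))

Σℤ-- : ∀ n (f g : Fin n → ℤ) → Σℤ n (λ i → f i ℤ.- g i) ≡ Σℤ n f ℤ.- Σℤ n g
Σℤ-- zero    f g = refl
Σℤ-- (suc n) f g =
  trans (cong (λ s → (f zero ℤ.- g zero) ℤ.+ s) (Σℤ-- n (λ i → f (suc i)) (λ i → g (suc i))))
        (interchange (f zero) (g zero) _ _)
  where interchange : ∀ a b S T → (a ℤ.- b) ℤ.+ (S ℤ.- T) ≡ (a ℤ.+ S) ℤ.- (b ℤ.+ T)
        interchange = solve-∀

Σℤ-parity : ∀ n (f : Fin n → ℤ) (g : Fin n → Fin 2) → (∀ i → Parity (f i) (g i)) →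
  Parity (Σℤ n f) (⊕-sum n g)
Σℤ-parity zero    f g h = + 0 , refl
Σℤ-parity (suc n) f g h = parity-+ (h zero) (Σℤ-parity n (λ i → f (suc i)) (λ i → g (suc i)) (λ i → h (suc i)))

Σℤ-+ : ∀ n (g : Fin n → ℕ) → Σℤ n (λ i → + g i) ≡ + Σℕ n g
Σℤ-+ zero    g = refl
Σℤ-+ (suc n) g = trans (cong (λ s → + g zero ℤ.+ s) (Σℤ-+ n (λ i → g (suc i)))) (≡-sym (ℤP.pos-+ (g zero) _))

Σℕ-cong : ∀ n {f g : Fin n → ℕ} → (∀ i → f i ≡ g i) → Σℕ n f ≡ Σℕ n g
Σℕ-cong zero    e = refl
Σℕ-cong (suc n) e = cong₂ _+_ (e zero) (Σℕ-cong n (λ i → e (suc i)))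

Σℕ-*ˡ : ∀ n c (g : Fin n → ℕ) → Σℕ n (λ i → c ℕ.* g i) ≡ c ℕ.* Σℕ n g
Σℕ-*ˡ zero    c g = ≡-sym (ℕP.*-zeroʳ c)
Σℕ-*ˡ (suc n) c g =
  trans (cong (λ s → c ℕ.* g zero + s) (Σℕ-*ˡ n c (λ i → g (suc i)))) (≡-sym (ℕP.*-distribˡ-+ c (g zero) _))

Σℕ-last : ∀ m (g : Fin (suc m) → ℕ) → Σℕ (suc m) g ≡ Σℕ m (λ j → g (inject₁ j)) + g (fromℕ m)
Σℕ-last zero    g = ℕP.+-comm (g zero) 0
Σℕ-last (suc m) g = trans (cong (λ s → g zero + s) (Σℕ-last m (λ i → g (suc i)))) (≡-sym (ℕP.+-assoc (g zero) _ _))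

split-bound : ∀ Q c t n → c ≤ Q → t ≤ Q → n + suc Q ≡ c + t ℕ.* suc (suc Q) → 2 + n ≤ suc Q ℕ.* suc Q
split-bound Q c t n c≤Q t≤Q split = ℕP.+-cancelʳ-≤ (suc Q) _ _ (begin
  2 + n + suc Q                 ≡⟨ ℕP.+-assoc 2 n (suc Q) ⟩
  2 + (n + suc Q)               ≡⟨ cong (λ x → 2 + x) split ⟩
  2 + (c + t ℕ.* suc (suc Q))   ≤⟨ ℕP.+-monoʳ-≤ 2 (ℕP.+-mono-≤ c≤Q (ℕP.*-monoˡ-≤ (suc (suc Q)) t≤Q)) ⟩
  2 + (Q + Q ℕ.* suc (suc Q))   ≡⟨ expand Q ⟩
  suc Q ℕ.* suc Q + suc Q       ∎)
  where
  open ℕP.≤-Reasoning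
  expand : ∀ Q → 2 + (Q + Q ℕ.* suc (suc Q)) ≡ suc Q ℕ.* suc Q + suc Q
  expand = ℕSolver.solve-∀

-- Base-p digits

%-of-+* : ∀ a k d .{{_ : NonZero d}} → a < d → (a + k ℕ.* d) ℕ.% d ≡ a
%-of-+* a k d a<d = trans (ℕD.[m+kn]%n≡m%n a k d) (ℕD.m<n⇒m%n≡m a<d)

/-of-+* : ∀ a k d .{{_ : NonZero d}} → a < d → (a + k ℕ.* d) ℕ./ d ≡ k
/-of-+* a k d a<d =
  trans (ℕD.+-distrib-/-∣ʳ a (divides-refl k)) (cong₂ _+_ (ℕD.m<n⇒m/n≡0 a<d) (ℕD.m*n/n≡m k d))

module Digits (p : ℕ) .{{_ : NonZero p}} where

  value : (k : ℕ) → (Fin (suc k) → ℕ) → ℕ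
  value k a = Σℕ (suc k) (λ i → p ^ toℕ i ℕ.* a i)

  digit : ℕ → ∀ {n} → Fin n → ℕ
  digit c i = (c ℕ./ p ^ toℕ i) {{ℕP.m^n≢0 p (toℕ i)}} ℕ.% p

  value-cong : ∀ k {a b : Fin (suc k) → ℕ} → (∀ i → a i ≡ b i) → value k a ≡ value k b
  value-cong k e = Σℕ-cong (suc k) (λ i → cong (p ^ toℕ i ℕ.*_) (e i))

  value-zero : ∀ (a : Fin 1 → ℕ) → value 0 a ≡ a zero
  value-zero a = trans (ℕP.+-identityʳ _) (ℕP.*-identityˡ (a zero))

  value-suc : ∀ k (a : Fin (suc (suc k)) → ℕ) → value (suc k) a ≡ a zero + value k (λ i → a (suc i)) ℕ.* p
  value-suc k a = cong₂ _+_ (ℕP.*-identityˡ (a zero)) (begin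
    Σℕ (suc k) (λ i → p ℕ.* p ^ toℕ i ℕ.* a (suc i))  ≡⟨ Σℕ-cong (suc k) (λ i → ℕP.*-assoc p (p ^ toℕ i) (a (suc i))) ⟩
    Σℕ (suc k) (λ i → p ℕ.* (p ^ toℕ i ℕ.* a (suc i))) ≡⟨ Σℕ-*ˡ (suc k) p (λ i → p ^ toℕ i ℕ.* a (suc i)) ⟩
    p ℕ.* value k (λ i → a (suc i))                    ≡⟨ ℕP.*-comm p _ ⟩
    value k (λ i → a (suc i)) ℕ.* p                    ∎)
    where open ≡-Reasoning

  digit-zero : ∀ c {n} → digit c {suc n} zero ≡ c ℕ.% p
  digit-zero c = cong (ℕ._% p) (ℕD.n/1≡n c)

  digit-suc : ∀ c {n} (i : Fin n) → digit c (suc i) ≡ digit (c ℕ./ p) i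
  digit-suc c i = cong (ℕ._% p)
    (≡-sym (ℕD.m/n/o≡m/[n*o] c p (p ^ toℕ i) {{_}} {{ℕP.m^n≢0 p (toℕ i)}} {{ℕP.m^n≢0 p (suc (toℕ i))}}))

  /-< : ∀ c X → c < p ℕ.* X → c ℕ./ p < X
  /-< c X c<pX = ℕP.*-cancelʳ-< p (c ℕ./ p) X (ℕP.≤-<-trans (ℕD.m/n*n≤m c p) (subst (c <_) (ℕP.*-comm p X) c<pX))

  value-digits : ∀ k c → c < p ^ suc k → value k (digit c) ≡ c
  value-digits zero c c<p =
    trans (value-zero (digit c)) (trans (digit-zero c {0}) (ℕD.m<n⇒m%n≡m (subst (c <_) (ℕP.*-identityʳ p) c<p)))
  value-digits (suc k) c c<p = begin
    value (suc k) (digit c)                        ≡⟨ value-suc k (digit c) ⟩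
    digit c {suc (suc k)} zero + value k (λ i → digit c (suc i)) ℕ.* p
      ≡⟨ cong₂ (λ x y → x + y ℕ.* p) (digit-zero c {suc k}) (value-cong k (digit-suc c)) ⟩
    c ℕ.% p + value k (digit (c ℕ./ p)) ℕ.* p       ≡⟨ cong (λ y → c ℕ.% p + y ℕ.* p) (value-digits k (c ℕ./ p) (/-< c _ c<p)) ⟩
    c ℕ.% p + (c ℕ./ p) ℕ.* p                      ≡⟨ ≡-sym (ℕD.m≡m%n+[m/n]*n c p) ⟩
    c                                              ∎
    where open ≡-Reasoning

  digits-injective : ∀ k {c c′} → c < p ^ suc k → c′ < p ^ suc k → (∀ i → digit c {suc k} i ≡ digit c′ i) → c ≡ c′
  digits-injective k {c} {c′} c< c′< same =
    trans (≡-sym (value-digits k c c<)) (trans (value-cong k same) (value-digits k c′ c′<))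

  value< : ∀ k (a : Fin (suc k) → ℕ) → (∀ i → a i < p) → value k a < p ^ suc k
  value< zero    a a<p = subst₂ _<_ (≡-sym (value-zero a)) (≡-sym (ℕP.*-identityʳ p)) (a<p zero)
  value< (suc k) a a<p = subst (_< p ^ suc (suc k)) (≡-sym (value-suc k a)) (begin-strict
    a zero + V ℕ.* p      <⟨ ℕP.+-monoˡ-< (V ℕ.* p) (a<p zero) ⟩
    p + V ℕ.* p           ≡⟨⟩
    suc V ℕ.* p           ≤⟨ ℕP.*-monoˡ-≤ p (value< k (λ i → a (suc i)) (λ i → a<p (suc i))) ⟩
    p ^ suc k ℕ.* p       ≡⟨ ℕP.*-comm (p ^ suc k) p ⟩
    p ^ suc (suc k)       ∎)
    where
    open ℕP.≤-Reasoning
    V = value k (λ i → a (suc i))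

  digit-value : ∀ k (a : Fin (suc k) → ℕ) → (∀ i → a i < p) → ∀ i → digit (value k a) i ≡ a i
  digit-value zero a a<p zero =
    trans (digit-zero (value zero a) {0}) (trans (cong (ℕ._% p) (value-zero a)) (ℕD.m<n⇒m%n≡m (a<p zero)))
  digit-value (suc k) a a<p zero =
    trans (digit-zero (value (suc k) a) {suc k}) (trans (cong (ℕ._% p) (value-suc k a)) (%-of-+* (a zero) (value k (λ i → a (suc i))) p (a<p zero)))
  digit-value (suc k) a a<p (suc i) =
    trans (digit-suc (value (suc k) a) i)
      (trans (cong (λ x → digit x i) (trans (cong (ℕ._/ p) (value-suc k a)) (/-of-+* (a zero) (value k (λ i → a (suc i))) p (a<p zero))))
             (digit-value k (λ i → a (suc i)) (λ i → a<p (suc i)) i))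

-- The condition U_v, and coincidences between the ψ̄_{u,v}

δ₀ : ∀ {m} → Fin (suc m) → Fin 2
δ₀ zero    = one
δ₀ (suc _) = zero

infixl 6 _⊕ᵥ_
_⊕ᵥ_ : ∀ {m} → Bin m → Bin m → Bin m
(u ⊕ᵥ v) i = u i ⊕ v i

jump : ∀ {m} → Bin m → Bin m → Fin (suc m) → Fin 2
jump u v i = (u ⊕ᵥ v) i ⊕ (u ⊕ᵥ v) (prev i) ⊕ δ₀ i

NoJumps : ∀ {m} → Bin m → Bin m → Set
NoJumps v u = ∀ i → v (prev i) ≡ one → jump u v i ≡ zero

Coincide : ∀ {m} → Bin m → Bin m → Bin m → Bin m → Set
Coincide u v u′ v′ =
  (∀ i → (u ⊕ᵥ v) i ≡ (u′ ⊕ᵥ v′) i) × (∀ i → v (prev i) ≢ v′ (prev i) → jump u v i ≡ one)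

Congℤ₂⇒⊕ : ∀ {a b x e} → Parity x e → Congℤ (bit a ℤ.- bit b) x 2 → a ⊕ b ≡ e
Congℤ₂⇒⊕ {a} {b} {x} {e} px c =
  ⊕≡0⇒≡ _ _ (parity-unique (parity-- (parity-- (parity-bit a) (parity-bit b)) px)
                           (Congℤ₂⇒even {bit a ℤ.- bit b} {x} c))

⊕⇒Congℤ₂ : ∀ {a b x e} → Parity x e → a ⊕ b ≡ e → Congℤ (bit a ℤ.- bit b) x 2
⊕⇒Congℤ₂ {a} {b} {x} {e} px a⊕b≡e =
  even⇒Congℤ₂ {bit a ℤ.- bit b} {x}
    (subst (Parity _) (≡⇒⊕≡0 _ _ a⊕b≡e) (parity-- (parity-- (parity-bit a) (parity-bit b)) px))

jump≡0⇒ : ∀ a b c d e → a ⊕ c ⊕ (b ⊕ d) ⊕ e ≡ zero → b ⊕ a ≡ e ⊕ (d ⊕ c)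
jump≡0⇒ = by-truth-table

⇒jump≡0 : ∀ a b c d e → b ⊕ a ≡ e ⊕ (d ⊕ c) → a ⊕ c ⊕ (b ⊕ d) ⊕ e ≡ zero
⇒jump≡0 = by-truth-table

module _ {m} (v u : Bin m) where

  private
    wrap-parity : Parity (bit (v (lastI m)) ℤ.- bit (v zero) ℤ.+ + 1) (one ⊕ (v (lastI m) ⊕ v zero))
    wrap-parity = subst (Parity _) (⊕-comm _ one)
                        (parity-+ (parity-- (parity-bit (v (lastI m))) (parity-bit (v zero))) (parity-bit one))

    step-parity : ∀ j → Parity (bit (v (inject₁ j)) ℤ.- bit (v (suc j))) (v (inject₁ j) ⊕ v (suc j))
    step-parity j = parity-- (parity-bit (v (inject₁ j))) (parity-bit (v (suc j)))

  InU⇒NoJumps : InU m v u → NoJumps v u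
  InU⇒NoJumps (wrap , step) zero    v₋₁ =
    ⇒jump≡0 (u zero) (u (lastI m)) (v zero) (v (lastI m)) one
      (Congℤ₂⇒⊕ {u (lastI m)} {u zero} wrap-parity (wrap v₋₁))
  InU⇒NoJumps (wrap , step) (suc j) v₋₁ =
    ⇒jump≡0 (u (suc j)) (u (inject₁ j)) (v (suc j)) (v (inject₁ j)) zero
      (Congℤ₂⇒⊕ {u (inject₁ j)} {u (suc j)} (step-parity j) (step j v₋₁))

  NoJumps⇒InU : NoJumps v u → InU m v u
  NoJumps⇒InU h =
    (λ v₋₁ → ⊕⇒Congℤ₂ {u (lastI m)} {u zero} wrap-parity
               (jump≡0⇒ (u zero) (u (lastI m)) (v zero) (v (lastI m)) one (h zero v₋₁))) ,
    (λ j v₋₁ → ⊕⇒Congℤ₂ {u (inject₁ j)} {u (suc j)} (step-parity j)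
                 (jump≡0⇒ (u (suc j)) (u (inject₁ j)) (v (suc j)) (v (inject₁ j)) zero (h (suc j) v₋₁)))

-- Counting solutions of U_v

_◃_ : ∀ {k} → Fin 2 → (Fin (suc k) → Fin 2) → Fin (suc (suc k)) → Fin 2
(a ◃ w) zero    = a
(a ◃ w) (suc i) = w i

◃-≗ : ∀ {k a} {w′ : Fin (suc k) → Fin 2} {w} → w zero ≡ a → w′ ≗ (w ∘ suc) → (a ◃ w′) ≗ w
◃-≗ start w′≗ zero    = ≡-sym start
◃-≗ start w′≗ (suc i) = w′≗ i

Path : (k : ℕ) → (Fin k → Fin 2) → Fin 2 → Fin 2 → (Fin (suc k) → Fin 2) → Set
Path k fixed a b w =
  (w zero ≡ a) × (w (fromℕ k) ≡ b) × (∀ j → fixed j ≡ one → w (suc j) ≡ w (inject₁ j))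

◃-Path : ∀ {k fixed a c b w} → Path k (fixed ∘ suc) c b w → (fixed zero ≡ one → c ≡ a) →
  Path (suc k) fixed a b (a ◃ w)
◃-Path (start , end , steps) link = refl , end , λ { zero f → trans start (link f) ; (suc j) f → steps j f }

paths : (k : ℕ) → (Fin k → Fin 2) → Fin 2 → Fin 2 → List (Fin (suc k) → Fin 2)
paths zero    fixed zero       zero       = [ (λ _ → zero) ]
paths zero    fixed zero       (suc zero) = []
paths zero    fixed (suc zero) zero       = []
paths zero    fixed (suc zero) (suc zero) = [ (λ _ → one) ]
paths (suc k) fixed a b with fixed zero
... | zero     = map (a ◃_) (paths k (fixed ∘ suc) zero b ++ paths k (fixed ∘ suc) one b)
... | suc zero = map (a ◃_) (paths k (fixed ∘ suc) a b)

paths-sound : ∀ k fixed a b {w} → w ∈ paths k fixed a b → Path k fixed a b w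
paths-sound zero    fixed zero       zero       (here refl) = refl , refl , λ ()
paths-sound zero    fixed zero       (suc zero) ()
paths-sound zero    fixed (suc zero) zero       ()
paths-sound zero    fixed (suc zero) (suc zero) (here refl) = refl , refl , λ ()
paths-sound (suc k) fixed a b w∈ with fixed zero in fixed₀
... | zero with ∈-map⁻ (a ◃_) w∈
...   | w′ , w′∈ , refl with ∈-++⁻ (paths k (fixed ∘ suc) zero b) w′∈
...     | inj₁ w′∈₀ = ◃-Path (paths-sound k (fixed ∘ suc) zero b w′∈₀) (λ f → ⊥-elim (0≢1 (trans (≡-sym fixed₀) f)))
...     | inj₂ w′∈₁ = ◃-Path (paths-sound k (fixed ∘ suc) one b w′∈₁) (λ f → ⊥-elim (0≢1 (trans (≡-sym fixed₀) f)))
paths-sound (suc k) fixed a b w∈ | suc zero with ∈-map⁻ (a ◃_) w∈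
... | w′ , w′∈ , refl = ◃-Path (paths-sound k (fixed ∘ suc) a b w′∈) (λ _ → refl)

paths-complete : ∀ k fixed a b (w : Fin (suc k) → Fin 2) → Path k fixed a b w →
  Σ (Fin (suc k) → Fin 2) λ w′ → w′ ∈ paths k fixed a b × w′ ≗ w
paths-complete zero fixed a b w (refl , refl , _) with w zero in w₀
... | zero     = (λ _ → zero) , here refl , λ { zero → ≡-sym w₀ }
... | suc zero = (λ _ → one) , here refl , λ { zero → ≡-sym w₀ }
paths-complete (suc k) fixed a b w (start , end , steps) with fixed zero in fixed₀
... | zero with bit-cases (w (suc zero))
...   | inj₁ w₁ with paths-complete k (fixed ∘ suc) zero b (w ∘ suc) (w₁ , end , λ j → steps (suc j))
...     | w′ , w′∈ , w′≗ = a ◃ w′ , ∈-map⁺ (a ◃_) (∈-++⁺ˡ w′∈) , ◃-≗ start w′≗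
paths-complete (suc k) fixed a b w (start , end , steps) | zero | inj₂ w₁
  with paths-complete k (fixed ∘ suc) one b (w ∘ suc) (w₁ , end , λ j → steps (suc j))
... | w′ , w′∈ , w′≗ = a ◃ w′ , ∈-map⁺ (a ◃_) (∈-++⁺ʳ (paths k (fixed ∘ suc) zero b) w′∈) , ◃-≗ start w′≗
paths-complete (suc k) fixed a b w (start , end , steps) | suc zero
  with paths-complete k (fixed ∘ suc) a b (w ∘ suc) (trans (steps zero fixed₀) start , end , λ j → steps (suc j))
... | w′ , w′∈ , w′≗ = a ◃ w′ , ∈-map⁺ (a ◃_) w′∈ , ◃-≗ start w′≗

Distinct : ∀ {k} → List (Fin k → Fin 2) → Set
Distinct = AllPairs (λ w w′ → ¬ w ≗ w′)

all-pairs : ∀ {A : Set} {R : A → A → Set} (xs ys : List A) →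
  (∀ {x y} → x ∈ xs → y ∈ ys → R x y) → All (λ x → All (R x) ys) xs
all-pairs xs ys r = All.tabulate λ x∈ → All.tabulate λ y∈ → r x∈ y∈

paths-apart : ∀ {k fixed a b a′ b′ w w′} → w ∈ paths k fixed a b → w′ ∈ paths k fixed a′ b′ →
  (a ≢ a′) ⊎ (b ≢ b′) → ¬ w ≗ w′
paths-apart {k} {fixed} {a} {b} {a′} {b′} w∈ w′∈ (inj₁ a≢a′) w≗w′ =
  a≢a′ (trans (≡-sym (proj₁ (paths-sound k fixed a b w∈))) (trans (w≗w′ zero) (proj₁ (paths-sound k fixed a′ b′ w′∈))))
paths-apart {k} {fixed} {a} {b} {a′} {b′} w∈ w′∈ (inj₂ b≢b′) w≗w′ =
  b≢b′ (trans (≡-sym (proj₁ (proj₂ (paths-sound k fixed a b w∈))))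
              (trans (w≗w′ (fromℕ k)) (proj₁ (proj₂ (paths-sound k fixed a′ b′ w′∈)))))

◃-distinct : ∀ {k} a {ws : List (Fin (suc k) → Fin 2)} → Distinct ws → Distinct (map (a ◃_) ws)
◃-distinct a d = AllPairsₚ.map⁺ (AllPairs.map (λ w≉w′ ◃w≗◃w′ → w≉w′ (◃w≗◃w′ ∘ suc)) d)

paths-distinct : ∀ k fixed a b → Distinct (paths k fixed a b)
paths-distinct zero    fixed zero       zero       = All.[] ∷ []
paths-distinct zero    fixed zero       (suc zero) = []
paths-distinct zero    fixed (suc zero) zero       = []
paths-distinct zero    fixed (suc zero) (suc zero) = All.[] ∷ []
paths-distinct (suc k) fixed a b with fixed zero
... | zero     = ◃-distinct a (AllPairsₚ.++⁺ (paths-distinct k (fixed ∘ suc) zero b) (paths-distinct k (fixed ∘ suc) one b)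
                   (all-pairs _ _ λ w∈ w′∈ → paths-apart w∈ w′∈ (inj₁ 0≢1)))
... | suc zero = ◃-distinct a (paths-distinct k (fixed ∘ suc) a b)

free : (k : ℕ) → (Fin k → Fin 2) → ℕ
free zero    fixed = 0
free (suc k) fixed = toℕ (one ⊕ fixed zero) + free k (fixed ∘ suc)

fixed+free : ∀ k (fixed : Fin k → Fin 2) → Σℕ k (λ j → toℕ (fixed j)) + free k fixed ≡ k
fixed+free zero    fixed = refl
fixed+free (suc k) fixed with fixed zero
... | zero     = trans (ℕP.+-suc _ _) (cong suc (fixed+free k (fixed ∘ suc)))
... | suc zero = cong suc (fixed+free k (fixed ∘ suc))

-- A path with no free step is constant; a free step splits the paths evenly between the two ends.
pathCount : ℕ → Fin 2 → Fin 2 → ℕ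
pathCount zero    a b = toℕ (one ⊕ a ⊕ b)
pathCount (suc z) a b = 2 ^ z

pathCount-split : ∀ z b → pathCount z zero b + pathCount z one b ≡ 2 ^ z
pathCount-split zero    zero       = refl
pathCount-split zero    (suc zero) = refl
pathCount-split (suc z) b          = cong (λ x → 2 ^ z + x) (≡-sym (ℕP.+-identityʳ (2 ^ z)))

paths-length : ∀ k fixed a b → length (paths k fixed a b) ≡ pathCount (free k fixed) a b
paths-length zero    fixed zero       zero       = refl
paths-length zero    fixed zero       (suc zero) = refl
paths-length zero    fixed (suc zero) zero       = refl
paths-length zero    fixed (suc zero) (suc zero) = refl
paths-length (suc k) fixed a b with fixed zero
... | zero = begin
  length (map (a ◃_) (paths k (fixed ∘ suc) zero b ++ paths k (fixed ∘ suc) one b))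
    ≡⟨ Listₚ.length-map (a ◃_) (paths k (fixed ∘ suc) zero b ++ _) ⟩
  length (paths k (fixed ∘ suc) zero b ++ paths k (fixed ∘ suc) one b)
    ≡⟨ Listₚ.length-++ (paths k (fixed ∘ suc) zero b) ⟩
  length (paths k (fixed ∘ suc) zero b) + length (paths k (fixed ∘ suc) one b)
    ≡⟨ cong₂ _+_ (paths-length k (fixed ∘ suc) zero b) (paths-length k (fixed ∘ suc) one b) ⟩
  pathCount (free k (fixed ∘ suc)) zero b + pathCount (free k (fixed ∘ suc)) one b
    ≡⟨ pathCount-split (free k (fixed ∘ suc)) b ⟩
  2 ^ free k (fixed ∘ suc) ∎
  where open ≡-Reasoning
... | suc zero = trans (Listₚ.length-map (a ◃_) (paths k (fixed ∘ suc) a b)) (paths-length k (fixed ∘ suc) a b)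

step≡0⇒≡ : ∀ a b → a ⊕ b ⊕ zero ≡ zero → a ≡ b
step≡0⇒≡ = by-truth-table

module Cycles {m} (v : Bin m) where

  private
    fixed : Fin m → Fin 2
    fixed = v ∘ inject₁

    P : Fin 2 → Fin 2 → List (Bin m)
    P = paths m fixed

  Steps : Bin m → Set
  Steps w = ∀ j → v (inject₁ j) ≡ one → w (suc j) ≡ w (inject₁ j)

  Wraps : Bin m → Set
  Wraps w = v (lastI m) ≡ one → w zero ⊕ w (lastI m) ≡ one

  NoJumps⇒Steps×Wraps : ∀ {u} → NoJumps v u → Steps (u ⊕ᵥ v) × Wraps (u ⊕ᵥ v)
  NoJumps⇒Steps×Wraps {u} noJumps =
    (λ j vⱼ → step≡0⇒≡ _ _ (noJumps (suc j) vⱼ)) , λ vₗ → wrap≡0⇒ ((u ⊕ᵥ v) zero) ((u ⊕ᵥ v) (lastI m)) (noJumps zero vₗ)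
    where
    wrap≡0⇒ : ∀ a b → a ⊕ b ⊕ one ≡ zero → a ⊕ b ≡ one
    wrap≡0⇒ = by-truth-table

  Steps×Wraps⇒NoJumps : ∀ {w} → Steps w → Wraps w → NoJumps v (w ⊕ᵥ v)
  Steps×Wraps⇒NoJumps {w} steps wraps zero vₗ = ⇒wrap≡0 (w zero) (w (lastI m)) (v zero) (v (lastI m)) (wraps vₗ)
    where
    ⇒wrap≡0 : ∀ a b c d → a ⊕ b ≡ one → a ⊕ c ⊕ c ⊕ (b ⊕ d ⊕ d) ⊕ one ≡ zero
    ⇒wrap≡0 = by-truth-table
  Steps×Wraps⇒NoJumps {w} steps wraps (suc j) vⱼ =
    ⇒step≡0 (w (suc j)) (w (inject₁ j)) (v (suc j)) (v (inject₁ j)) (steps j vⱼ)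
    where
    ⇒step≡0 : ∀ a b c d → a ≡ b → a ⊕ c ⊕ c ⊕ (b ⊕ d ⊕ d) ⊕ zero ≡ zero
    ⇒step≡0 = by-truth-table

  -- The solutions with v_{f-1} = e, listed by their end bits (w₀, w_{f-1}).
  cyclesFor : Fin 2 → List (Bin m)
  cyclesFor zero       = P zero zero ++ P zero one ++ P one zero ++ P one one
  cyclesFor (suc zero) = P zero one ++ P one zero

  cycles : List (Bin m)
  cycles = cyclesFor (v (lastI m))

  private
    path-solves : ∀ {a b w} → w ∈ P a b → (v (lastI m) ≡ one → a ⊕ b ≡ one) → Steps w × Wraps w
    path-solves w∈ ends with paths-sound m fixed _ _ w∈
    ... | refl , refl , steps = steps , ends

    cyclesFor-sound : ∀ e → v (lastI m) ≡ e → ∀ {w} → w ∈ cyclesFor e → Steps w × Wraps w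
    cyclesFor-sound zero vₗ w∈ with ∈-++⁻ (P zero zero) w∈
    ... | inj₁ w∈₀₀ = path-solves w∈₀₀ (λ vₗ≡1 → ⊥-elim (0≢1 (trans (≡-sym vₗ) vₗ≡1)))
    ... | inj₂ w∈′ with ∈-++⁻ (P zero one) w∈′
    ...   | inj₁ w∈₀₁ = path-solves w∈₀₁ (λ _ → refl)
    ...   | inj₂ w∈″ with ∈-++⁻ (P one zero) w∈″
    ...     | inj₁ w∈₁₀ = path-solves w∈₁₀ (λ _ → refl)
    ...     | inj₂ w∈₁₁ = path-solves w∈₁₁ (λ vₗ≡1 → ⊥-elim (0≢1 (trans (≡-sym vₗ) vₗ≡1)))
    cyclesFor-sound (suc zero) vₗ w∈ with ∈-++⁻ (P zero one) w∈
    ... | inj₁ w∈₀₁ = path-solves w∈₀₁ (λ _ → refl)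
    ... | inj₂ w∈₁₀ = path-solves w∈₁₀ (λ _ → refl)

    place : ∀ e a b → v (lastI m) ≡ e → (v (lastI m) ≡ one → a ⊕ b ≡ one) →
      ∀ {w} → w ∈ P a b → w ∈ cyclesFor e
    place zero       zero       zero       _  _    w∈ = ∈-++⁺ˡ w∈
    place zero       zero       (suc zero) _  _    w∈ = ∈-++⁺ʳ (P zero zero) (∈-++⁺ˡ w∈)
    place zero       (suc zero) zero       _  _    w∈ = ∈-++⁺ʳ (P zero zero) (∈-++⁺ʳ (P zero one) (∈-++⁺ˡ w∈))
    place zero       (suc zero) (suc zero) _  _    w∈ =
      ∈-++⁺ʳ (P zero zero) (∈-++⁺ʳ (P zero one) (∈-++⁺ʳ (P one zero) w∈))
    place (suc zero) zero       zero       vₗ ends w∈ with ends vₗ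
    ... | ()
    place (suc zero) zero       (suc zero) _  _    w∈ = ∈-++⁺ˡ w∈
    place (suc zero) (suc zero) zero       _  _    w∈ = ∈-++⁺ʳ (P zero one) w∈
    place (suc zero) (suc zero) (suc zero) vₗ ends w∈ with ends vₗ
    ... | ()

    apart-start : ∀ {b b′ w w′} → w ∈ P zero b → w′ ∈ P one b′ → ¬ w ≗ w′
    apart-start w∈ w′∈ = paths-apart w∈ w′∈ (inj₁ 0≢1)

    apart-end : ∀ {a a′ w w′} → w ∈ P a zero → w′ ∈ P a′ one → ¬ w ≗ w′
    apart-end w∈ w′∈ = paths-apart w∈ w′∈ (inj₂ 0≢1)

    cyclesFor-distinct : ∀ e → Distinct (cyclesFor e)
    cyclesFor-distinct zero =
      AllPairsₚ.++⁺ (paths-distinct m fixed zero zero)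
        (AllPairsₚ.++⁺ (paths-distinct m fixed zero one)
          (AllPairsₚ.++⁺ (paths-distinct m fixed one zero) (paths-distinct m fixed one one)
            (all-pairs _ _ apart-end))
          (all-pairs _ _ λ w∈ w′∈ → [ apart-start w∈ , apart-start w∈ ]′ (∈-++⁻ (P one zero) w′∈)))
        (all-pairs _ _ λ w∈ w′∈ → [ apart-end w∈ , (λ w′∈″ → [ apart-start w∈ , apart-start w∈ ]′ (∈-++⁻ (P one zero) w′∈″)) ]′
                                    (∈-++⁻ (P zero one) w′∈))
    cyclesFor-distinct (suc zero) =
      AllPairsₚ.++⁺ (paths-distinct m fixed zero one) (paths-distinct m fixed one zero) (all-pairs _ _ apart-start)

  cycles-sound : ∀ {w} → w ∈ cycles → Steps w × Wraps w
  cycles-sound = cyclesFor-sound (v (lastI m)) refl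

  cycles-complete : ∀ w → Steps w → Wraps w → Σ (Bin m) λ w′ → w′ ∈ cycles × w′ ≗ w
  cycles-complete w steps wraps with paths-complete m fixed (w zero) (w (lastI m)) w (refl , refl , steps)
  ... | w′ , w′∈ , w′≗w = w′ , place (v (lastI m)) (w zero) (w (lastI m)) refl wraps w′∈ , w′≗w

  cycles-distinct : Distinct cycles
  cycles-distinct = cyclesFor-distinct (v (lastI m))

  private
    z : ℕ
    z = free m fixed

    ℓ+free : ℓ v + z ≡ m + toℕ (v (lastI m))
    ℓ+free = begin
      ℓ v + z                                     ≡⟨ cong (_+ z) (Σℕ-last m (λ i → toℕ (v i))) ⟩
      Σℕ m (λ j → toℕ (fixed j)) + toℕ (v (lastI m)) + z ≡⟨ swap (Σℕ m (λ j → toℕ (fixed j))) (toℕ (v (lastI m))) z ⟩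
      Σℕ m (λ j → toℕ (fixed j)) + z + toℕ (v (lastI m)) ≡⟨ cong (_+ toℕ (v (lastI m))) (fixed+free m fixed) ⟩
      m + toℕ (v (lastI m))                        ∎
      where
      open ≡-Reasoning
      swap : ∀ a b c → a + b + c ≡ a + c + b
      swap = ℕSolver.solve-∀

    four-ends : ∀ z → pathCount z zero zero + (pathCount z zero one + (pathCount z one zero + pathCount z one one))
                      ≡ 2 ^ suc z
    four-ends zero    = refl
    four-ends (suc z) = quadruple (2 ^ z)
      where quadruple : ∀ x → x + (x + (x + x)) ≡ 2 ℕ.* (2 ℕ.* x)
            quadruple = ℕSolver.solve-∀

    length-4 : ∀ (a b c d : List (Bin m)) → length (a ++ b ++ c ++ d) ≡ length a + (length b + (length c + length d))
    length-4 a b c d = trans (Listₚ.length-++ a) (cong (λ n → length a + n) (trans (Listₚ.length-++ b) (cong (λ n → length b + n) (Listₚ.length-++ c))))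

    cyclesFor-length : ∀ e → ℓ v < suc m → ℓ v + z ≡ m + toℕ e → length (cyclesFor e) ≡ 2 ^ (suc m ∸ ℓ v)
    cyclesFor-length zero ℓ<f ℓ+z = begin
      length (cyclesFor zero)  ≡⟨ length-4 (P zero zero) (P zero one) (P one zero) (P one one) ⟩
      _                        ≡⟨ cong₂ _+_ (paths-length m fixed zero zero) (cong₂ _+_ (paths-length m fixed zero one)
                                    (cong₂ _+_ (paths-length m fixed one zero) (paths-length m fixed one one))) ⟩
      _                        ≡⟨ four-ends z ⟩
      2 ^ suc z                ≡⟨ cong (2 ^_) (≡-sym f∸ℓ) ⟩
      2 ^ (suc m ∸ ℓ v)        ∎
      where
      open ≡-Reasoning
      f∸ℓ : suc m ∸ ℓ v ≡ suc z
      f∸ℓ = trans (cong (_∸ ℓ v) (trans (cong suc (trans (≡-sym (ℕP.+-identityʳ m)) (≡-sym ℓ+z))) (≡-sym (ℕP.+-suc (ℓ v) z))))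
                  (ℕP.m+n∸m≡n (ℓ v) (suc z))
    cyclesFor-length (suc zero) ℓ<f ℓ+z = trans (Listₚ.length-++ (P zero one))
      (trans (cong₂ _+_ (paths-length m fixed zero one) (paths-length m fixed one zero)) (two-ends z ℓ+z))
      where
      f∸ℓ : ∀ z → ℓ v + z ≡ m + 1 → suc m ∸ ℓ v ≡ z
      f∸ℓ z ℓ+z = trans (cong (_∸ ℓ v) (trans (ℕP.+-comm 1 m) (≡-sym ℓ+z))) (ℕP.m+n∸m≡n (ℓ v) z)
      two-ends : ∀ z → ℓ v + z ≡ m + 1 → pathCount z zero one + pathCount z one zero ≡ 2 ^ (suc m ∸ ℓ v)
      two-ends zero    ℓ+0 = ⊥-elim (ℕP.<-irrefl (trans (≡-sym (ℕP.+-identityʳ (ℓ v))) (trans ℓ+0 (ℕP.+-comm m 1))) ℓ<f)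
      two-ends (suc z) ℓ+z = trans (cong (λ x → 2 ^ z + x) (≡-sym (ℕP.+-identityʳ (2 ^ z))))
                                   (cong (2 ^_) (≡-sym (f∸ℓ (suc z) ℓ+z)))

  cycles-length : ℓ v < suc m → length cycles ≡ 2 ^ (suc m ∸ ℓ v)
  cycles-length ℓ<f = cyclesFor-length (v (lastI m)) ℓ<f ℓ+free

≤ᵥ-antisym : ∀ {m} {v v′ : Bin m} → v ≤ᵥ v′ → v′ ≤ᵥ v → ∀ i → v i ≡ v′ i
≤ᵥ-antisym {v = v} {v′} v≤v′ v′≤v i with bit-cases (v i) | bit-cases (v′ i)
... | inj₂ vᵢ | _        = trans vᵢ (≡-sym (v≤v′ i vᵢ))
... | inj₁ vᵢ | inj₂ v′ᵢ = ⊥-elim (0≢1 (trans (≡-sym vᵢ) (v′≤v i v′ᵢ)))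
... | inj₁ vᵢ | inj₁ v′ᵢ = trans vᵢ (≡-sym v′ᵢ)

module Classification {m : ℕ} {C : Set} (Is : C → Bin m → Bin m → Set)
  (Is-exists : ∀ u v → Σ C λ ψ → Is ψ u v)
  (coincide⇒ : ∀ ψ u v u′ v′ → Is ψ u v → Is ψ u′ v′ → Coincide u v u′ v′)
  (coincide⇐ : ∀ ψ ψ′ u v u′ v′ → Is ψ u v → Is ψ′ u′ v′ → Coincide u v u′ v′ → ψ ≡ ψ′)
  where

  -- W_D^v(ρ̄) and W_{D,v}(ρ̄), named after the position of the index v.
  Upper : Bin m → C → Set
  Upper v ψ = Σ (Bin m) λ u → InU m v u × Is ψ u v

  Lower : Bin m → C → Set
  Lower v ψ = Σ (Bin m) λ u → Is ψ u v

  InU⇒≤ᵥ : ∀ (v u : Bin m) (ψ : C) → InU m v u → Is ψ u v →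
    ∀ (u′ v′ : Bin m) → Is ψ u′ v′ → v ≤ᵥ v′
  InU⇒≤ᵥ v u ψ inU is u′ v′ is′ i vᵢ with bit-cases (v′ i)
  ... | inj₂ v′ᵢ = v′ᵢ
  ... | inj₁ v′ᵢ = ⊥-elim (0≢1 (trans (≡-sym no-jump) jumps))
    where
    v₋₁ : v (prev (next i)) ≡ one
    v₋₁ = trans (cong v (prev-next i)) vᵢ
    v′₋₁ : v′ (prev (next i)) ≡ zero
    v′₋₁ = trans (cong v′ (prev-next i)) v′ᵢ
    no-jump : jump u v (next i) ≡ zero
    no-jump = InU⇒NoJumps v u inU (next i) v₋₁
    jumps : jump u v (next i) ≡ one
    jumps = proj₂ (coincide⇒ ψ u v u′ v′ is is′) (next i) λ e → 0≢1 (trans (≡-sym v′₋₁) (trans (≡-sym e) v₋₁))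

  Upper-disjoint : ∀ (v v′ : Bin m) (ψ : C) → Upper v ψ → Upper v′ ψ → ∀ i → v i ≡ v′ i
  Upper-disjoint v v′ ψ (u , inU , is) (u′ , inU′ , is′) =
    ≤ᵥ-antisym (InU⇒≤ᵥ v u ψ inU is u′ v′ is′) (InU⇒≤ᵥ v′ u′ ψ inU′ is′ u v is)

  -- With every v_i = 1, InU forces u ⊕ v to be constant around the cycle, but the wrap-around step flips it.
  Upper-full-empty : ∀ (v : Bin m) → ℓ v ≡ suc m → ∀ ψ → ¬ Upper v ψ
  Upper-full-empty v ℓv≡f ψ (u , inU , _) =
    no-constant-wrap (w zero) (trans (cong (λ x → w zero ⊕ x ⊕ one) (≡-sym (w-constant (lastI m)))) (no-jump zero))
    where
    w = u ⊕ᵥ v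
    v≡1 = Σℕ-bits≡n⇒all-one (suc m) v ℓv≡f
    no-jump : ∀ i → jump u v i ≡ zero
    no-jump i = InU⇒NoJumps v u inU i (v≡1 (prev i))
    no-constant-wrap : ∀ a → a ⊕ a ⊕ one ≢ zero
    no-constant-wrap = by-truth-table
    w-constant : ∀ i → w i ≡ w zero
    w-constant = constant-by-steps m w (λ k → step≡0⇒≡ _ _ (no-jump (suc k)))

  module Reduce (u v : Bin m) where

    v⁻ : Bin m
    v⁻ i = sel (jump u v (next i)) (v i) zero

    u⁻ : Bin m
    u⁻ = (u ⊕ᵥ v) ⊕ᵥ v⁻

    ⊕ᵥ-same : ∀ i → (u⁻ ⊕ᵥ v⁻) i ≡ (u ⊕ᵥ v) i
    ⊕ᵥ-same i = ⊕-cancelʳ ((u ⊕ᵥ v) i) (v⁻ i)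

    jump-same : ∀ i → jump u⁻ v⁻ i ≡ jump u v i
    jump-same i = cong₂ (λ a b → a ⊕ b ⊕ δ₀ i) (⊕ᵥ-same i) (⊕ᵥ-same (prev i))

    v⁻-prev : ∀ i → v⁻ (prev i) ≡ sel (jump u v i) (v (prev i)) zero
    v⁻-prev i = cong (λ j → sel (jump u v j) (v (prev i)) zero) (next-prev i)

    v⁻≤v : v⁻ ≤ᵥ v
    v⁻≤v i v⁻ᵢ with sel-cases (jump u v (next i)) (v i) zero
    ... | inj₁ (_ , kept)    = trans (≡-sym kept) v⁻ᵢ
    ... | inj₂ (_ , dropped) = ⊥-elim (0≢1 (trans (≡-sym dropped) v⁻ᵢ))

    reduce-InU : InU m v⁻ u⁻
    reduce-InU = NoJumps⇒InU v⁻ u⁻ no-jump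
      where
      no-jump : NoJumps v⁻ u⁻
      no-jump i v⁻₋₁ with sel-cases (jump u v i) (v (prev i)) zero
      ... | inj₁ (j≡0 , _)     = trans (jump-same i) j≡0
      ... | inj₂ (_ , dropped) = ⊥-elim (0≢1 (trans (≡-sym dropped) (trans (≡-sym (v⁻-prev i)) v⁻₋₁)))

    reduce-coincide : Coincide u⁻ v⁻ u v
    reduce-coincide = ⊕ᵥ-same , λ i v⁻₋₁≢v₋₁ → trans (jump-same i) (jumps i v⁻₋₁≢v₋₁)
      where
      jumps : ∀ i → v⁻ (prev i) ≢ v (prev i) → jump u v i ≡ one
      jumps i ne with sel-cases (jump u v i) (v (prev i)) zero
      ... | inj₂ (j≡1 , _)  = j≡1
      ... | inj₁ (_ , kept) = ⊥-elim (ne (trans (v⁻-prev i) kept))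

    reduce-Is : ∀ {ψ} → Is ψ u v → Is ψ u⁻ v⁻
    reduce-Is {ψ} is with Is-exists u⁻ v⁻
    ... | ψ⁻ , is⁻ = subst (λ χ → Is χ u⁻ v⁻) (coincide⇐ ψ⁻ ψ u⁻ v⁻ u v is⁻ is reduce-coincide) is⁻

  WD⇒Upper : ∀ (ψ : C) → (Σ (Bin m) λ u → Σ (Bin m) λ v → Is ψ u v) → Σ (Bin m) λ v → Upper v ψ
  WD⇒Upper ψ (u , v , is) = v⁻ , u⁻ , reduce-InU , reduce-Is is
    where open Reduce u v

  Upper⇒minimal : ∀ (v : Bin m) (ψ : C) → Upper v ψ → Lower v ψ × (∀ v′ → v′ <ᵥ v → ¬ Lower v′ ψ)
  Upper⇒minimal v ψ (u , inU , is) =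
    (u , is) , λ { v′ (v′≤v , v′≢v) (u′ , is′) →
      v′≢v λ i → ≡-sym (≤ᵥ-antisym (InU⇒≤ᵥ v u ψ inU is u′ v′ is′) v′≤v i) }

  minimal⇒Upper : ∀ (v : Bin m) (ψ : C) → Lower v ψ × (∀ v′ → v′ <ᵥ v → ¬ Lower v′ ψ) → Upper v ψ
  minimal⇒Upper v ψ ((u , is) , minimal) with FinP.all? (λ i → v⁻ i FinP.≟ v i)
    where open Reduce u v
  ... | no v⁻≢v = ⊥-elim (minimal v⁻ (v⁻≤v , v⁻≢v) (u⁻ , reduce-Is is))
    where open Reduce u v
  ... | yes v⁻≡v = u , NoJumps⇒InU v u no-jump , is
    where
    open Reduce u v
    no-jump : NoJumps v u
    no-jump i v₋₁ = trans (≡-sym (jump-same i)) (InU⇒NoJumps v⁻ u⁻ reduce-InU i (trans (v⁻≡v (prev i)) v₋₁))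

  WD⇔⋃Upper : ∀ (ψ : C) →
    ((Σ (Bin m) λ u → Σ (Bin m) λ v → Is ψ u v) → Σ (Bin m) λ v → Upper v ψ)
    × ((Σ (Bin m) λ v → Upper v ψ) → Σ (Bin m) λ u → Σ (Bin m) λ v → Is ψ u v)
  WD⇔⋃Upper ψ = WD⇒Upper ψ , λ { (v , u , _ , is) → u , v , is }

  Upper⇔minimal : ∀ (v : Bin m) (ψ : C) →
    (Upper v ψ → Lower v ψ × (∀ v′ → v′ <ᵥ v → ¬ Lower v′ ψ))
    × (Lower v ψ × (∀ v′ → v′ <ᵥ v → ¬ Lower v′ ψ) → Upper v ψ)
  Upper⇔minimal v ψ = Upper⇒minimal v ψ , minimal⇒Upper v ψ

  Upper-size : ∀ (v : Bin m) → ℓ v < suc m → HasSize (Upper v) (2 ^ (suc m ∸ ℓ v))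
  Upper-size v ℓ<f =
    map label cycles , distinct-labels , trans (Listₚ.length-map label cycles) (cycles-length ℓ<f) ,
    λ ψ → labelled-member ψ , member-labelled ψ
    where
    open Cycles v
    label : Bin m → C
    label w = proj₁ (Is-exists (w ⊕ᵥ v) v)

    labelled : ∀ w → Is (label w) (w ⊕ᵥ v) v
    labelled w = proj₂ (Is-exists (w ⊕ᵥ v) v)

    distinct-labels : Unique (map label cycles)
    distinct-labels = AllPairsₚ.map⁺ (AllPairs.map distinct cycles-distinct)
      where
      distinct : ∀ {w w′} → ¬ w ≗ w′ → label w ≢ label w′
      distinct {w} {w′} w≉w′ same = w≉w′ λ i →
        trans (≡-sym (⊕-cancelʳ (w i) (v i)))
              (trans (proj₁ (coincide⇒ (label w) (w ⊕ᵥ v) v (w′ ⊕ᵥ v) v (labelled w)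
                                       (subst (λ χ → Is χ (w′ ⊕ᵥ v) v) (≡-sym same) (labelled w′))) i)
                     (⊕-cancelʳ (w′ i) (v i)))

    labelled-member : ∀ ψ → Upper v ψ → ψ ∈ map label cycles
    labelled-member ψ (u , inU , is) with NoJumps⇒Steps×Wraps {u} (InU⇒NoJumps v u inU)
    ... | steps , wraps with cycles-complete (u ⊕ᵥ v) steps wraps
    ...   | w , w∈ , w≗ =
      subst (_∈ map label cycles) (coincide⇐ (label w) ψ (w ⊕ᵥ v) v u v (labelled w) is coincide) (∈-map⁺ label w∈)
      where
      coincide : Coincide (w ⊕ᵥ v) v u v
      coincide = (λ i → trans (⊕-cancelʳ (w i) (v i)) (w≗ i)) , λ i v≢v → ⊥-elim (v≢v refl)

    member-labelled : ∀ ψ → ψ ∈ map label cycles → Upper v ψ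
    member-labelled ψ ψ∈ with ∈-map⁻ label ψ∈
    ... | w , w∈ , refl =
      w ⊕ᵥ v ,
      NoJumps⇒InU v (w ⊕ᵥ v) (Steps×Wraps⇒NoJumps {w} (proj₁ (cycles-sound w∈)) (proj₂ (cycles-sound w∈))) ,
      labelled w

-- The cuspidal types: the digits of c forced by Θ̄([ψ̄])_u ≅ σ_v(ρ̄)

offset : Fin 2 → Fin 2 → Fin 2 → ℤ
offset w x y = sel w (bit x ℤ.+ bit y) (bit y ℤ.- bit x)

offset-parity : ∀ w x y → Parity (offset w x y) (x ⊕ y)
offset-parity zero       x y = parity-+ (parity-bit x) (parity-bit y)
offset-parity (suc zero) x y = subst (Parity _) (⊕-comm y x) (parity-- (parity-bit y) (parity-bit x))

offset-crossing : ∀ w x y x′ y′ → offset w x y ≡ offset w x′ y′ → x ≢ x′ → y ≡ x ⊕ w ⊕ one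
offset-crossing = by-truth-table

offset-jump : ∀ w x x′ → offset w x (x ⊕ w ⊕ one) ≡ offset w x′ (x′ ⊕ w ⊕ one)
offset-jump = by-truth-table

unshift : ∀ b (P d L s : ℤ) → sel b (d ℤ.- + 1) (P ℤ.- + 2 ℤ.- d) ℤ.+ s ≡ L →
  d ≡ sel b (L ℤ.- s ℤ.+ + 1) (P ℤ.- + 2 ℤ.- L ℤ.+ s)
unshift zero       P d L s refl = undo d s
  where undo : ∀ d s → d ≡ d ℤ.- + 1 ℤ.+ s ℤ.- s ℤ.+ + 1
        undo = solve-∀
unshift (suc zero) P d L s refl = undo P d s
  where undo : ∀ P d s → d ≡ P ℤ.- + 2 ℤ.- (P ℤ.- + 2 ℤ.- d ℤ.+ s) ℤ.+ s
        undo = solve-∀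

reshift : ∀ b (P d L s : ℤ) → d ≡ sel b (L ℤ.- s ℤ.+ + 1) (P ℤ.- + 2 ℤ.- L ℤ.+ s) →
  sel b (d ℤ.- + 1) (P ℤ.- + 2 ℤ.- d) ℤ.+ s ≡ L
reshift zero       P d L s refl = redo L s
  where redo : ∀ L s → L ℤ.- s ℤ.+ + 1 ℤ.- + 1 ℤ.+ s ≡ L
        redo = solve-∀
reshift (suc zero) P d L s refl = redo P L s
  where redo : ∀ P L s → P ℤ.- + 2 ℤ.- (P ℤ.- + 2 ℤ.- L ℤ.+ s) ℤ.+ s ≡ L
        redo = solve-∀

-- Solving  sel uᵢ (cᵢ - 1) (p - 2 - cᵢ) + shiftᵢ = λ_{v,i}  for cᵢ.
solve-digit : ∀ ui vi y (R P X : ℤ) →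
  sel ui (sel vi (R ℤ.+ X) (P ℤ.- + 2 ℤ.- R ℤ.- X) ℤ.- bit (one ⊕ y ⊕ ui) ℤ.+ + 1)
         (P ℤ.- + 2 ℤ.- sel vi (R ℤ.+ X) (P ℤ.- + 2 ℤ.- R ℤ.- X) ℤ.+ bit (one ⊕ y ⊕ ui))
  ≡ sel (ui ⊕ vi) R (P ℤ.- + 2 ℤ.- R) ℤ.+ sel (ui ⊕ vi) (X ℤ.+ bit y) (bit y ℤ.- X)
solve-digit zero zero zero = eq
  where eq : ∀ R P X → R ℤ.+ X ℤ.- + 1 ℤ.+ + 1 ≡ R ℤ.+ (X ℤ.+ + 0)
        eq = solve-∀
solve-digit zero zero (suc zero) = eq
  where eq : ∀ R P X → R ℤ.+ X ℤ.- + 0 ℤ.+ + 1 ≡ R ℤ.+ (X ℤ.+ + 1)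
        eq = solve-∀
solve-digit zero (suc zero) zero = eq
  where eq : ∀ R P X → P ℤ.- + 2 ℤ.- R ℤ.- X ℤ.- + 1 ℤ.+ + 1 ≡ P ℤ.- + 2 ℤ.- R ℤ.+ (+ 0 ℤ.- X)
        eq = solve-∀
solve-digit zero (suc zero) (suc zero) = eq
  where eq : ∀ R P X → P ℤ.- + 2 ℤ.- R ℤ.- X ℤ.- + 0 ℤ.+ + 1 ≡ P ℤ.- + 2 ℤ.- R ℤ.+ (+ 1 ℤ.- X)
        eq = solve-∀
solve-digit (suc zero) zero zero = eq
  where eq : ∀ R P X → P ℤ.- + 2 ℤ.- (R ℤ.+ X) ℤ.+ + 0 ≡ P ℤ.- + 2 ℤ.- R ℤ.+ (+ 0 ℤ.- X)
        eq = solve-∀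
solve-digit (suc zero) zero (suc zero) = eq
  where eq : ∀ R P X → P ℤ.- + 2 ℤ.- (R ℤ.+ X) ℤ.+ + 1 ≡ P ℤ.- + 2 ℤ.- R ℤ.+ (+ 1 ℤ.- X)
        eq = solve-∀
solve-digit (suc zero) (suc zero) zero = eq
  where eq : ∀ R P X → P ℤ.- + 2 ℤ.- (P ℤ.- + 2 ℤ.- R ℤ.- X) ℤ.+ + 0 ≡ R ℤ.+ (X ℤ.+ + 0)
        eq = solve-∀
solve-digit (suc zero) (suc zero) (suc zero) = eq
  where eq : ∀ R P X → P ℤ.- + 2 ℤ.- (P ℤ.- + 2 ℤ.- R ℤ.- X) ℤ.+ + 1 ≡ R ℤ.+ (X ℤ.+ + 1)
        eq = solve-∀

module Theta (p : ℕ) .{{_ : NonZero p}} (p-odd : Parity (+ p) one) (m : ℕ)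
  (r : Fin (suc m) → ℕ) (r+3≤p : ∀ i → r i + 3 ≤ p) where

  open Digits p

  q : ℕ
  q = qOf p m

  q₁ : ℕ
  q₁ = q ∸ 1

  Is : Char p m → Bin m → Bin m → Set
  Is ψ u v = ThetaIs p m ψ u (sigma p m r v)

  c[_] : Char p m → ℕ
  c[ ψ ] = (toℕ ψ + q) ℕ.% suc q

  t[_] : Char p m → ℕ
  t[ ψ ] = (toℕ ψ + q) ℕ./ suc q

  carry : Bin m → Fin (suc m) → Fin 2
  carry u i = u (prev i) ⊕ δ₀ i

  base : ℕ → Fin 2 → ℤ
  base R w = sel w (+ R) (+ p ℤ.- + 2 ℤ.- + R)

  digitFor : ℕ → Fin 2 → Fin 2 → Fin 2 → ℤ
  digitFor R w x y = base R w ℤ.+ offset w x y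

  forcedDigit : Bin m → Bin m → Fin (suc m) → ℤ
  forcedDigit u v i = digitFor (r i) ((u ⊕ᵥ v) i) (v (prev i)) (carry u i)

  shift≡ : ∀ n u i → shift p m n u i ≡ bit (one ⊕ carry u i ⊕ u i)
  shift≡ n u zero    = wrap (u (lastI m)) (u zero)
    where wrap : ∀ a b → (if does (a FinP.≟ b) then + 0 else + 1) ≡ bit (one ⊕ (a ⊕ one) ⊕ b)
          wrap = by-truth-table
  shift≡ n u (suc j) = step (u (inject₁ j)) (u (suc j))
    where step : ∀ a b → (if does (a FinP.≟ b) then + 1 else + 0) ≡ bit (one ⊕ (a ⊕ zero) ⊕ b)
          step = by-truth-table

  thetaSym≡ : ∀ ψ u i → thetaSym p m (toℕ ψ) u i ≡
    sel (u i) (+ digit c[ ψ ] i ℤ.- + 1) (+ p ℤ.- + 2 ℤ.- + digit c[ ψ ] i) ℤ.+ bit (one ⊕ carry u i ⊕ u i)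
  thetaSym≡ ψ u i =
    cong (λ s → sel (u i) (+ digit c[ ψ ] i ℤ.- + 1) (+ p ℤ.- + 2 ℤ.- + digit c[ ψ ] i) ℤ.+ s) (shift≡ (toℕ ψ) u i)

  thetaSym≡lam⇒digit : ∀ ψ u v i → thetaSym p m (toℕ ψ) u i ≡ lam p m r v i → + digit c[ ψ ] i ≡ forcedDigit u v i
  thetaSym≡lam⇒digit ψ u v i eq =
    trans (unshift (u i) (+ p) _ _ _ (trans (≡-sym (thetaSym≡ ψ u i)) eq))
          (solve-digit (u i) (v i) (carry u i) (+ r i) (+ p) (bit (v (prev i))))

  digit⇒thetaSym≡lam : ∀ ψ u v i → + digit c[ ψ ] i ≡ forcedDigit u v i → thetaSym p m (toℕ ψ) u i ≡ lam p m r v i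
  digit⇒thetaSym≡lam ψ u v i eq =
    trans (thetaSym≡ ψ u i)
          (reshift (u i) (+ p) _ _ _ (trans eq (≡-sym (solve-digit (u i) (v i) (carry u i) (+ r i) (+ p) (bit (v (prev i)))))))

  base-parity : ∀ R w {ρ} → Parity (+ R) ρ → Parity (base R w) (w ⊕ ρ)
  base-parity R zero       pR = pR
  base-parity R (suc zero) pR = parity-- (parity-- p-odd parity-two) pR

  forcedDigit-parity : ∀ u v i {ρ} → Parity (+ r i) ρ → Parity (forcedDigit u v i) (ρ ⊕ jump u v i)
  forcedDigit-parity u v i {ρ} pR =
    subst (Parity _) (rearrange ((u ⊕ᵥ v) i) ρ (u (prev i)) (v (prev i)) (δ₀ i))
      (parity-+ (base-parity (r i) ((u ⊕ᵥ v) i) pR) (offset-parity ((u ⊕ᵥ v) i) (v (prev i)) (carry u i)))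
    where rearrange : ∀ w ρ a b d → w ⊕ ρ ⊕ (b ⊕ (a ⊕ d)) ≡ ρ ⊕ (w ⊕ (a ⊕ b) ⊕ d)
          rearrange = by-truth-table

  forcedDigits⇒Coincide : ∀ u v u′ v′ → (∀ i → forcedDigit u v i ≡ forcedDigit u′ v′ i) →
    (u ⊕ᵥ v) (lastI m) ≡ (u′ ⊕ᵥ v′) (lastI m) → Coincide u v u′ v′
  forcedDigits⇒Coincide u v u′ v′ same last = same-sum , crossing
    where
    same-jump : ∀ i → jump u v i ≡ jump u′ v′ i
    same-jump i with parity-exists (+ r i)
    ... | ρ , pR = ⊕-cancelˡ ρ _ _
      (parity-unique (forcedDigit-parity u v i pR)
                     (subst (λ d → Parity d _) (≡-sym (same i)) (forcedDigit-parity u′ v′ i pR)))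
      where ⊕-cancelˡ : ∀ a b c → a ⊕ b ≡ a ⊕ c → b ≡ c
            ⊕-cancelˡ = by-truth-table
    difference : Fin (suc m) → Fin 2
    difference i = (u ⊕ᵥ v) i ⊕ (u′ ⊕ᵥ v′) i
    difference-step : ∀ i → difference i ≡ difference (prev i)
    difference-step i = jumps-agree ((u ⊕ᵥ v) i) ((u ⊕ᵥ v) (prev i)) ((u′ ⊕ᵥ v′) i) ((u′ ⊕ᵥ v′) (prev i)) (δ₀ i) (same-jump i)
      where jumps-agree : ∀ a b a′ b′ d → a ⊕ b ⊕ d ≡ a′ ⊕ b′ ⊕ d → a ⊕ a′ ≡ b ⊕ b′
            jumps-agree = by-truth-table
    same-sum : ∀ i → (u ⊕ᵥ v) i ≡ (u′ ⊕ᵥ v′) i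
    same-sum i = ⊕≡0⇒≡ _ _ (trans (constant-by-steps m difference (λ k → difference-step (suc k)) i)
                                  (trans (difference-step zero) (≡⇒⊕≡0 _ _ last)))
    crossing : ∀ i → v (prev i) ≢ v′ (prev i) → jump u v i ≡ one
    crossing i x≢x′ = crossing-jumps ((u ⊕ᵥ v) i) (u (prev i)) (v (prev i)) (δ₀ i)
      (offset-crossing ((u ⊕ᵥ v) i) (v (prev i)) (carry u i) (v′ (prev i)) (carry u′ i)
        (+-cancelˡ (base (r i) ((u ⊕ᵥ v) i)) _ _
          (trans (same i) (cong (λ w → digitFor (r i) w (v′ (prev i)) (carry u′ i)) (≡-sym (same-sum i)))))
        x≢x′)
      where crossing-jumps : ∀ w a b d → a ⊕ d ≡ b ⊕ w ⊕ one → w ⊕ (a ⊕ b) ⊕ d ≡ one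
            crossing-jumps = by-truth-table

  Coincide⇒forcedDigits : ∀ u v u′ v′ → Coincide u v u′ v′ → ∀ i → forcedDigit u v i ≡ forcedDigit u′ v′ i
  Coincide⇒forcedDigits u v u′ v′ (same-sum , crossing) i with v (prev i) FinP.≟ v′ (prev i)
  ... | yes x≡x′ =
    trans (cong (λ w → digitFor (r i) w x y) (same-sum i))
          (cong₂ (digitFor (r i) w′) x≡x′ (cong (_⊕ δ₀ i) (same-other-half (same-sum (prev i)) x≡x′)))
    where
    x = v (prev i)
    y = carry u i
    w′ = (u′ ⊕ᵥ v′) i
    same-other-half : ∀ {a b a′ b′} → a ⊕ b ≡ a′ ⊕ b′ → b ≡ b′ → a ≡ a′
    same-other-half {a} {b} {a′} {b′} = halves a b a′ b′
      where halves : ∀ a b a′ b′ → a ⊕ b ≡ a′ ⊕ b′ → b ≡ b′ → a ≡ a′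
            halves = by-truth-table
  ... | no x≢x′ = begin
    digitFor (r i) w x (carry u i)             ≡⟨ cong (digitFor (r i) w x) (jump⇒carry {u} {v} jumps) ⟩
    digitFor (r i) w x (x ⊕ w ⊕ one)           ≡⟨ cong (λ o → base (r i) w ℤ.+ o) (offset-jump w x x′) ⟩
    digitFor (r i) w x′ (x′ ⊕ w ⊕ one)         ≡⟨ cong (λ w → digitFor (r i) w x′ (x′ ⊕ w ⊕ one)) (same-sum i) ⟩
    digitFor (r i) w′ x′ (x′ ⊕ w′ ⊕ one)       ≡⟨ cong (digitFor (r i) w′ x′) (≡-sym (jump⇒carry {u′} {v′} jumps′)) ⟩
    digitFor (r i) w′ x′ (carry u′ i)          ∎
    where
    open ≡-Reasoning
    x = v (prev i)
    x′ = v′ (prev i)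
    w = (u ⊕ᵥ v) i
    w′ = (u′ ⊕ᵥ v′) i
    jumps : jump u v i ≡ one
    jumps = crossing i x≢x′
    jumps′ : jump u′ v′ i ≡ one
    jumps′ = trans (cong₂ (λ a b → a ⊕ b ⊕ δ₀ i) (≡-sym (same-sum i)) (≡-sym (same-sum (prev i)))) jumps
    jump⇒carry : ∀ {u v} → jump u v i ≡ one → carry u i ≡ v (prev i) ⊕ (u ⊕ᵥ v) i ⊕ one
    jump⇒carry {u} {v} = carry-of-jump ((u ⊕ᵥ v) i) (u (prev i)) (v (prev i)) (δ₀ i)
      where carry-of-jump : ∀ w a b d → w ⊕ (a ⊕ b) ⊕ d ≡ one → a ⊕ d ≡ b ⊕ w ⊕ one
            carry-of-jump = by-truth-table

  private
    p≥3 : 3 ≤ p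
    p≥3 = ℕP.≤-trans (ℕP.m≤n+m 3 (r zero)) (r+3≤p zero)

    bit≤1 : ∀ (x : Fin 2) → toℕ x ≤ 1
    bit≤1 zero       = ℕ.z≤n
    bit≤1 (suc zero) = ℕ.s≤s ℕ.z≤n

    2+R+x≤p : ∀ R x → R + 3 ≤ p → 2 + R + toℕ x ≤ p
    2+R+x≤p R x R+3≤p = ℕP.≤-trans (ℕP.≤-trans (ℕP.+-monoʳ-≤ (2 + R) (bit≤1 x)) (ℕP.≤-reflexive (reorder R))) R+3≤p
      where reorder : ∀ R → 2 + R + 1 ≡ R + 3
            reorder = ℕSolver.solve-∀

    ∸-to-ℤ : ∀ a b → b ≤ a → + (a ∸ b) ≡ + a ℤ.- + b
    ∸-to-ℤ a b b≤a = ≡-sym (trans (ℤP.m-n≡m⊖n a b) (ℤP.⊖-≥ b≤a))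

  digitForℕ : ℕ → Fin 2 → Fin 2 → Fin 2 → ℕ
  digitForℕ R w x y = sel w (R + (toℕ x + toℕ y)) (p ∸ (2 + R + toℕ x) + toℕ y)

  digitForℕ-≡ : ∀ R w x y → R + 3 ≤ p → + digitForℕ R w x y ≡ digitFor R w x y
  digitForℕ-≡ R zero x y _ = trans (ℤP.pos-+ R (toℕ x + toℕ y)) (cong (λ o → + R ℤ.+ o) (ℤP.pos-+ (toℕ x) (toℕ y)))
  digitForℕ-≡ R (suc zero) x y R+3≤p = begin
    + (p ∸ (2 + R + toℕ x) + toℕ y)            ≡⟨ ℤP.pos-+ (p ∸ (2 + R + toℕ x)) (toℕ y) ⟩
    + (p ∸ (2 + R + toℕ x)) ℤ.+ bit y           ≡⟨ cong (ℤ._+ bit y) (∸-to-ℤ p _ (2+R+x≤p R x R+3≤p)) ⟩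
    + p ℤ.- + (2 + R + toℕ x) ℤ.+ bit y         ≡⟨ cong (λ z → + p ℤ.- z ℤ.+ bit y)
                                                    (trans (ℤP.pos-+ (2 + R) (toℕ x)) (cong (ℤ._+ bit x) (ℤP.pos-+ 2 R))) ⟩
    + p ℤ.- (+ 2 ℤ.+ + R ℤ.+ bit x) ℤ.+ bit y   ≡⟨ regroup (+ p) (+ R) (bit x) (bit y) ⟩
    + p ℤ.- + 2 ℤ.- + R ℤ.+ (bit y ℤ.- bit x)   ∎
    where
    open ≡-Reasoning
    regroup : ∀ P R X Y → P ℤ.- (+ 2 ℤ.+ R ℤ.+ X) ℤ.+ Y ≡ P ℤ.- + 2 ℤ.- R ℤ.+ (Y ℤ.- X)
    regroup = solve-∀

  digitForℕ-< : ∀ R w x y → R + 3 ≤ p → digitForℕ R w x y < p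
  digitForℕ-< R zero x y R+3≤p = ℕP.<-≤-trans (ℕ.s≤s (ℕP.+-monoʳ-≤ R (ℕP.+-mono-≤ (bit≤1 x) (bit≤1 y))))
                                               (ℕP.≤-trans (ℕP.≤-reflexive (reorder R)) R+3≤p)
    where reorder : ∀ R → suc (R + 2) ≡ R + 3
          reorder = ℕSolver.solve-∀
  digitForℕ-< R (suc zero) x y R+3≤p = ℕP.<-≤-trans
    (ℕ.s≤s (ℕP.+-mono-≤ (ℕP.∸-monoʳ-≤ p (ℕP.≤-trans (ℕP.m≤m+n 2 R) (ℕP.m≤m+n (2 + R) (toℕ x)))) (bit≤1 y)))
    (ℕP.≤-reflexive (trans (≡-sym (ℕP.+-suc (p ∸ 2) 1)) (ℕP.m∸n+n≡m (ℕP.≤-trans (ℕP.n≤1+n 2) p≥3))))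

  forcedDigitℕ : Bin m → Bin m → Fin (suc m) → ℕ
  forcedDigitℕ u v i = digitForℕ (r i) ((u ⊕ᵥ v) i) (v (prev i)) (carry u i)

  forcedDigitℕ-≡ : ∀ u v i → + forcedDigitℕ u v i ≡ forcedDigit u v i
  forcedDigitℕ-≡ u v i = digitForℕ-≡ (r i) _ _ _ (r+3≤p i)

  forcedDigitℕ-< : ∀ u v i → forcedDigitℕ u v i < p
  forcedDigitℕ-< u v i = digitForℕ-< (r i) _ _ _ (r+3≤p i)

  c⟨_,_⟩ : Bin m → Bin m → ℕ
  c⟨ u , v ⟩ = value m (forcedDigitℕ u v)

  c⟨⟩<q : ∀ u v → c⟨ u , v ⟩ < q
  c⟨⟩<q u v = value< m (forcedDigitℕ u v) (forcedDigitℕ-< u v)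

  digit-c⟨⟩ : ∀ u v i → + digit c⟨ u , v ⟩ i ≡ forcedDigit u v i
  digit-c⟨⟩ u v i = trans (cong +_ (digit-value m (forcedDigitℕ u v) (forcedDigitℕ-< u v) i)) (forcedDigitℕ-≡ u v i)

  c[]<q : ∀ ψ u v → Is ψ u v → c[ ψ ] < q
  c[]<q ψ u v (c≢q , _) = ℕP.≤∧≢⇒< (ℕP.≤-pred (ℕD.m%n<n (toℕ ψ + q) (suc q))) c≢q

  Is⇒c≡ : ∀ ψ u v → Is ψ u v → c[ ψ ] ≡ c⟨ u , v ⟩
  Is⇒c≡ ψ u v is@(_ , _ , sym≡ , _) = digits-injective m (c[]<q ψ u v is) (c⟨⟩<q u v) λ i →
    ℤP.+-injective (trans (thetaSym≡lam⇒digit ψ u v i (sym≡ i)) (≡-sym (digit-c⟨⟩ u v i)))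

  pow-odd : ∀ k → Parity (+ (p ^ k)) one
  pow-odd zero    = + 0 , refl
  pow-odd (suc k) = subst (λ z → Parity z one) (≡-sym (ℤP.pos-* p (p ^ k))) (parity-odd* p-odd (pow-odd k))

  private
    q≥1 : 1 ≤ q
    q≥1 = ℕP.m^n>0 p (suc m)

  q₁≡q-1 : + q₁ ≡ + q ℤ.- + 1
  q₁≡q-1 = ∸-to-ℤ q 1 q≥1

  q₁-even : Parity (+ q₁) zero
  q₁-even = subst (λ z → Parity z zero) (≡-sym q₁≡q-1) (parity-- (pow-odd (suc m)) (parity-bit one))

  r-minus-lam-parity : ∀ v i → Parity (+ r i ℤ.- lam p m r v i) (v (prev i) ⊕ v i)
  r-minus-lam-parity v i with parity-exists (+ r i) | v i
  ... | ρ , pR | zero     = subst (Parity _) (cancel ρ (v (prev i))) (parity-- pR (parity-+ pR (parity-bit (v (prev i)))))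
    where cancel : ∀ ρ x → ρ ⊕ (ρ ⊕ x) ≡ x ⊕ zero
          cancel = by-truth-table
  ... | ρ , pR | suc zero = subst (Parity _) (cancel ρ (v (prev i)))
                              (parity-- pR (parity-- (parity-- (parity-- p-odd parity-two) pR) (parity-bit (v (prev i)))))
    where cancel : ∀ ρ x → ρ ⊕ ((one ⊕ ρ) ⊕ x) ≡ x ⊕ one
          cancel = by-truth-table

  forced-minus-lam-parity : ∀ u v i → Parity (forcedDigit u v i ℤ.- lam p m r v i) (carry u i ⊕ u i)
  forced-minus-lam-parity u v i =
    subst (λ d → Parity (d ℤ.- lam p m r v i) _)
          (solve-digit (u i) (v i) (carry u i) (+ r i) (+ p) (bit (v (prev i))))
          (solved-parity (u i) (carry u i) (lam p m r v i))
    where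
    solved-parity : ∀ ui y L → Parity (sel ui (L ℤ.- bit (one ⊕ y ⊕ ui) ℤ.+ + 1)
                                            (+ p ℤ.- + 2 ℤ.- L ℤ.+ bit (one ⊕ y ⊕ ui)) ℤ.- L) (y ⊕ ui)
    solved-parity zero y L with parity-exists L
    ... | λ₂ , pL = subst (Parity _) (cancel λ₂ y)
                      (parity-- (parity-+ (parity-- pL (parity-bit (one ⊕ y ⊕ zero))) (parity-bit one)) pL)
      where cancel : ∀ l y → l ⊕ (one ⊕ y ⊕ zero) ⊕ one ⊕ l ≡ y ⊕ zero
            cancel = by-truth-table
    solved-parity (suc zero) y L with parity-exists L
    ... | λ₂ , pL = subst (Parity _) (cancel λ₂ y)
                      (parity-- (parity-+ (parity-- (parity-- p-odd parity-two) pL) (parity-bit (one ⊕ y ⊕ one))) pL)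
      where cancel : ∀ l y → (one ⊕ l) ⊕ (one ⊕ y ⊕ one) ⊕ l ≡ y ⊕ one
            cancel = by-truth-table

  Σp : (Fin (suc m) → ℤ) → ℤ
  Σp g = Σℤ (suc m) (λ i → + (p ^ toℕ i) ℤ.* g i)

  Σp-- : ∀ f g → Σp (λ i → f i ℤ.- g i) ≡ Σp f ℤ.- Σp g
  Σp-- f g = trans (Σℤ-cong (suc m) (λ i → distrib (+ (p ^ toℕ i)) (f i) (g i)))
                   (Σℤ-- (suc m) (λ i → + (p ^ toℕ i) ℤ.* f i) (λ i → + (p ^ toℕ i) ℤ.* g i))
    where distrib : ∀ P a b → P ℤ.* (a ℤ.- b) ≡ P ℤ.* a ℤ.- P ℤ.* b
          distrib = solve-∀

  Σp-parity : ∀ (g : Fin (suc m) → ℤ) (b : Fin (suc m) → Fin 2) → (∀ i → Parity (g i) (b i)) →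
    Parity (Σp g) (⊕-sum (suc m) b)
  Σp-parity g b pg = Σℤ-parity (suc m) _ _ λ i → parity-odd* (pow-odd (toℕ i)) (pg i)

  c⟨⟩-as-Σp : ∀ u v → + c⟨ u , v ⟩ ≡ Σp (forcedDigit u v)
  c⟨⟩-as-Σp u v = trans (≡-sym (Σℤ-+ (suc m) (λ i → p ^ toℕ i ℕ.* forcedDigitℕ u v i)))
    (Σℤ-cong (suc m) λ i → trans (ℤP.pos-* (p ^ toℕ i) _) (cong (+ (p ^ toℕ i) ℤ.*_) (forcedDigitℕ-≡ u v i)))

  -- Y v / 2 = e(λ_v)(r, p); X u v / 2 is the rest of the determinant exponent of Θ̄([ψ̄])_u once its digits are forced.
  Y : Bin m → ℤ
  Y v = Σp (λ i → + r i ℤ.- lam p m r v i) ℤ.+ + q₁ ℤ.* bit (v (lastI m))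

  X : Bin m → Bin m → ℤ
  X u v = + 1 ℤ.+ + c⟨ u , v ⟩ ℤ.- Σp (lam p m r v) ℤ.+ + q₁ ℤ.* bit (u (lastI m))

  Y-even : ∀ v → Parity (Y v) zero
  Y-even v = parity-+ (subst (Parity _) cycle-closes (Σp-parity _ _ (r-minus-lam-parity v)))
                      (parity-even* (bit (v (lastI m))) q₁-even)
    where
    cycle-closes : ⊕-sum (suc m) (λ i → v (prev i) ⊕ v i) ≡ zero
    cycle-closes = trans (cong (v (lastI m) ⊕ v zero ⊕_) (⊕-sum-telescope m v)) (vanish (v (lastI m)) (v zero))
      where vanish : ∀ a b → a ⊕ b ⊕ (b ⊕ a) ≡ zero
            vanish = by-truth-table

  X-even : ∀ u v → Parity (X u v) zero
  X-even u v = subst (λ x → Parity x zero) (≡-sym X≡)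
    (parity-+ (parity-+ (parity-bit one) (subst (Parity _) cycle-closes (Σp-parity _ _ (forced-minus-lam-parity u v))))
              (parity-even* (bit (u (lastI m))) q₁-even))
    where
    X≡ : X u v ≡ + 1 ℤ.+ Σp (λ i → forcedDigit u v i ℤ.- lam p m r v i) ℤ.+ + q₁ ℤ.* bit (u (lastI m))
    X≡ = trans (cong (λ c → + 1 ℤ.+ c ℤ.- Σp (lam p m r v) ℤ.+ + q₁ ℤ.* bit (u (lastI m))) (c⟨⟩-as-Σp u v))
               (trans (regroup (Σp (forcedDigit u v)) (Σp (lam p m r v)) (+ q₁ ℤ.* bit (u (lastI m))))
                      (cong (λ d → + 1 ℤ.+ d ℤ.+ + q₁ ℤ.* bit (u (lastI m))) (≡-sym (Σp-- (forcedDigit u v) (lam p m r v)))))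
      where regroup : ∀ C S Q → + 1 ℤ.+ C ℤ.- S ℤ.+ Q ≡ + 1 ℤ.+ (C ℤ.- S) ℤ.+ Q
            regroup = solve-∀
    -- δ₀ contributes the single 1 that makes the sum odd.
    cycle-closes : ⊕-sum (suc m) (λ i → carry u i ⊕ u i) ≡ one
    cycle-closes = trans (cong (u (lastI m) ⊕ one ⊕ u zero ⊕_)
                          (trans (⊕-sum-cong m (λ j → cong (_⊕ u (suc j)) (⊕-identityʳ (u (inject₁ j))))) (⊕-sum-telescope m u)))
                         (odd (u (lastI m)) (u zero))
      where odd : ∀ a b → a ⊕ one ⊕ b ⊕ (b ⊕ a) ≡ one
            odd = by-truth-table

  Z : Bin m → Bin m → ℤ
  Z u v = Y v ℤ./ℕ 2 ℤ.- X u v ℤ./ℕ 2 ℤ.+ + 1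

  gap : Bin m → Bin m → ℤ
  gap u v = bit (v (lastI m)) ℤ.- bit (u (lastI m))

  Z-double : ∀ u v → Z u v ℤ.+ Z u v ≡ Σp (λ i → + r i) ℤ.+ + 1 ℤ.- + c⟨ u , v ⟩ ℤ.+ + q₁ ℤ.* gap u v
  Z-double u v = begin
    Z u v ℤ.+ Z u v
      ≡⟨ regroup (Y v ℤ./ℕ 2) (X u v ℤ./ℕ 2) ⟩
    (Y v ℤ./ℕ 2 ℤ.+ Y v ℤ./ℕ 2) ℤ.- (X u v ℤ./ℕ 2 ℤ.+ X u v ℤ./ℕ 2) ℤ.+ + 2
      ≡⟨ cong₂ (λ y x → y ℤ.- x ℤ.+ + 2) (≡-sym (half-double (Y-even v))) (≡-sym (half-double (X-even u v))) ⟩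
    Y v ℤ.- X u v ℤ.+ + 2
      ≡⟨ cong (λ s → s ℤ.+ + q₁ ℤ.* bit (v (lastI m)) ℤ.- X u v ℤ.+ + 2) (Σp-- (λ i → + r i) (lam p m r v)) ⟩
    (Σp (λ i → + r i) ℤ.- Σp (lam p m r v)) ℤ.+ + q₁ ℤ.* bit (v (lastI m)) ℤ.- X u v ℤ.+ + 2
      ≡⟨ expand (Σp (λ i → + r i)) (Σp (lam p m r v)) (+ q₁) (bit (v (lastI m))) (+ c⟨ u , v ⟩) (bit (u (lastI m))) ⟩
    Σp (λ i → + r i) ℤ.+ + 1 ℤ.- + c⟨ u , v ⟩ ℤ.+ + q₁ ℤ.* gap u v ∎
    where
    open ≡-Reasoning
    regroup : ∀ y x → y ℤ.- x ℤ.+ + 1 ℤ.+ (y ℤ.- x ℤ.+ + 1) ≡ (y ℤ.+ y) ℤ.- (x ℤ.+ x) ℤ.+ + 2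
    regroup = solve-∀
    expand : ∀ R S Q V c U → (R ℤ.- S) ℤ.+ Q ℤ.* V ℤ.- (+ 1 ℤ.+ c ℤ.- S ℤ.+ Q ℤ.* U) ℤ.+ + 2
                             ≡ R ℤ.+ + 1 ℤ.- c ℤ.+ Q ℤ.* (V ℤ.- U)
    expand = solve-∀

  thetaDet-minus-eLam : ∀ ψ u v → c[ ψ ] ≡ c⟨ u , v ⟩ → (∀ i → thetaSym p m (toℕ ψ) u i ≡ lam p m r v i) →
    thetaDet p m (toℕ ψ) u ℤ.- eLam p m r v ≡ + t[ ψ ] ℤ.- Z u v
  thetaDet-minus-eLam ψ u v c≡ sym≡ = begin
    thetaDet p m (toℕ ψ) u ℤ.- eLam p m r v
      ≡⟨ cong₂ (λ c s → (+ t[ ψ ] ℤ.- + 1) ℤ.+ (+ 1 ℤ.+ + c ℤ.- s ℤ.+ + q₁ ℤ.* bit (u (lastI m))) ℤ./ℕ 2 ℤ.- eLam p m r v)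
               c≡ (Σℤ-cong (suc m) λ i → cong (+ (p ^ toℕ i) ℤ.*_) (sym≡ i)) ⟩
    (+ t[ ψ ] ℤ.- + 1) ℤ.+ X u v ℤ./ℕ 2 ℤ.- Y v ℤ./ℕ 2
      ≡⟨ regroup (+ t[ ψ ]) (X u v ℤ./ℕ 2) (Y v ℤ./ℕ 2) ⟩
    + t[ ψ ] ℤ.- Z u v ∎
    where
    open ≡-Reasoning
    regroup : ∀ t x y → (t ℤ.- + 1) ℤ.+ x ℤ.- y ≡ t ℤ.- (y ℤ.- x ℤ.+ + 1)
    regroup = solve-∀

  Is⇒t≡Z : ∀ ψ u v → Is ψ u v → Congℤ (+ t[ ψ ]) (Z u v) q₁
  Is⇒t≡Z ψ u v is@(_ , _ , sym≡ , det≡) =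
    subst (λ d → + q₁ ∣ d) (thetaDet-minus-eLam ψ u v (Is⇒c≡ ψ u v is) sym≡) det≡

  instance
    q₁-nonZero : NonZero q₁
    q₁-nonZero = ℕ.>-nonZero (ℕP.≤-trans (ℕ.s≤s ℕ.z≤n) (ℕP.∸-monoˡ-≤ 1 (ℕP.≤-trans p≥3 (ℕP.m≤m*n p (p ^ m) {{ℕP.m^n≢0 p m}}))))

  ψ-split : ∀ ψ → toℕ ψ + q ≡ c[ ψ ] + t[ ψ ] ℕ.* suc q
  ψ-split ψ = ℕD.m≡m%n+[m/n]*n (toℕ ψ + q) (suc q)

  ψ-injective : ∀ {ψ ψ′} → c[ ψ ] ≡ c[ ψ′ ] → t[ ψ ] ≡ t[ ψ′ ] → ψ ≡ ψ′
  ψ-injective {ψ} {ψ′} c≡ t≡ = FinP.toℕ-injective (ℕP.+-cancelʳ-≡ q (toℕ ψ) (toℕ ψ′)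
    (trans (ψ-split ψ) (trans (cong₂ (λ c t → c + t ℕ.* suc q) c≡ t≡) (≡-sym (ψ-split ψ′)))))

  t[]≥1 : ∀ ψ → c[ ψ ] < q → 1 ≤ t[ ψ ]
  t[]≥1 ψ c<q with t[ ψ ] | ψ-split ψ
  ... | suc _ | _     = ℕ.s≤s ℕ.z≤n
  ... | zero  | split = ⊥-elim (ℕP.<⇒≱ c<q (ℕP.≤-trans (ℕP.m≤n+m q (toℕ ψ)) (ℕP.≤-reflexive (trans split (ℕP.+-identityʳ _)))))

  t[]≤q₁ : ∀ ψ → t[ ψ ] ≤ q₁
  t[]≤q₁ ψ = ℕP.<⇒≤pred (ℕP.*-cancelʳ-< (suc q) t[ ψ ] q (begin-strict
    t[ ψ ] ℕ.* suc q                ≤⟨ ℕP.m≤n+m _ c[ ψ ] ⟩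
    c[ ψ ] + t[ ψ ] ℕ.* suc q       ≡⟨ ≡-sym (ψ-split ψ) ⟩
    toℕ ψ + q                       <⟨ ℕP.+-monoˡ-< q (ℕP.<-≤-trans (FinP.toℕ<n ψ) (ℕP.m∸n≤m (q ℕ.* q) 1)) ⟩
    q ℕ.* q + q                     ≡⟨ ℕP.+-comm (q ℕ.* q) q ⟩
    q + q ℕ.* q                     ≡⟨ ≡-sym (ℕP.*-suc q q) ⟩
    q ℕ.* suc q                     ∎))
    where open ℕP.≤-Reasoning

  gap-parity : ∀ u v u′ v′ → Parity (gap u v ℤ.- gap u′ v′) ((u ⊕ᵥ v) (lastI m) ⊕ (u′ ⊕ᵥ v′) (lastI m))
  gap-parity u v u′ v′ =
    subst (Parity _) (swap (v (lastI m)) (u (lastI m)) (v′ (lastI m)) (u′ (lastI m)))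
      (parity-- (parity-- (parity-bit (v (lastI m))) (parity-bit (u (lastI m))))
                (parity-- (parity-bit (v′ (lastI m))) (parity-bit (u′ (lastI m)))))
    where swap : ∀ a b c d → a ⊕ b ⊕ (c ⊕ d) ≡ b ⊕ a ⊕ (d ⊕ c)
          swap = by-truth-table

  Z-difference : ∀ u v u′ v′ → c⟨ u , v ⟩ ≡ c⟨ u′ , v′ ⟩ →
    (Z u v ℤ.- Z u′ v′) ℤ.+ (Z u v ℤ.- Z u′ v′) ≡ + q₁ ℤ.* (gap u v ℤ.- gap u′ v′)
  Z-difference u v u′ v′ c≡ = begin
    (Z u v ℤ.- Z u′ v′) ℤ.+ (Z u v ℤ.- Z u′ v′)  ≡⟨ regroup (Z u v) (Z u′ v′) ⟩
    (Z u v ℤ.+ Z u v) ℤ.- (Z u′ v′ ℤ.+ Z u′ v′)  ≡⟨ cong₂ ℤ._-_ (Z-double u v)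
                                                     (trans (Z-double u′ v′) (cong (λ c → R ℤ.+ + 1 ℤ.- + c ℤ.+ + q₁ ℤ.* gap u′ v′) (≡-sym c≡))) ⟩
    (R ℤ.+ + 1 ℤ.- + c⟨ u , v ⟩ ℤ.+ + q₁ ℤ.* gap u v) ℤ.- (R ℤ.+ + 1 ℤ.- + c⟨ u , v ⟩ ℤ.+ + q₁ ℤ.* gap u′ v′)
                                                 ≡⟨ cancel R (+ c⟨ u , v ⟩) (+ q₁) (gap u v) (gap u′ v′) ⟩
    + q₁ ℤ.* (gap u v ℤ.- gap u′ v′)             ∎
    where
    open ≡-Reasoning
    R = Σp (λ i → + r i)
    regroup : ∀ a b → (a ℤ.- b) ℤ.+ (a ℤ.- b) ≡ (a ℤ.+ a) ℤ.- (b ℤ.+ b)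
    regroup = solve-∀
    cancel : ∀ R c Q g g′ → (R ℤ.+ + 1 ℤ.- c ℤ.+ Q ℤ.* g) ℤ.- (R ℤ.+ + 1 ℤ.- c ℤ.+ Q ℤ.* g′) ≡ Q ℤ.* (g ℤ.- g′)
    cancel = solve-∀

  Z≡⇒gap-even : ∀ u v u′ v′ → c⟨ u , v ⟩ ≡ c⟨ u′ , v′ ⟩ → Congℤ (Z u v) (Z u′ v′) q₁ →
    Parity (gap u v ℤ.- gap u′ v′) zero
  Z≡⇒gap-even u v u′ v′ c≡ Z≡ = halve (Congℤ-witness {Z u v} {Z u′ v′} Z≡)
    where
    halve : (Σ ℤ λ k → Z u v ℤ.- Z u′ v′ ≡ k ℤ.* + q₁) → Parity (gap u v ℤ.- gap u′ v′) zero
    halve (k , Z-Z′) = k , ℤP.*-cancelˡ-≡ (+ q₁) _ _ (begin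
      + q₁ ℤ.* (gap u v ℤ.- gap u′ v′)             ≡⟨ ≡-sym (Z-difference u v u′ v′ c≡) ⟩
      (Z u v ℤ.- Z u′ v′) ℤ.+ (Z u v ℤ.- Z u′ v′)  ≡⟨ cong (λ d → d ℤ.+ d) Z-Z′ ⟩
      k ℤ.* + q₁ ℤ.+ k ℤ.* + q₁                    ≡⟨ collect k (+ q₁) ⟩
      + q₁ ℤ.* (+ 0 ℤ.+ k ℤ.* + 2)                 ∎)
      where
      open ≡-Reasoning
      collect : ∀ k Q → k ℤ.* Q ℤ.+ k ℤ.* Q ≡ Q ℤ.* (+ 0 ℤ.+ k ℤ.* + 2)
      collect = solve-∀

  gap-even⇒Z≡ : ∀ u v u′ v′ → c⟨ u , v ⟩ ≡ c⟨ u′ , v′ ⟩ → Parity (gap u v ℤ.- gap u′ v′) zero →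
    Congℤ (Z u v) (Z u′ v′) q₁
  gap-even⇒Z≡ u v u′ v′ c≡ (j , gap≡) = Congℤ-intro {Z u v} {Z u′ v′} (j , ℤP.*-cancelʳ-≡ _ _ (+ 2) (begin
    (Z u v ℤ.- Z u′ v′) ℤ.* + 2                  ≡⟨ double (Z u v ℤ.- Z u′ v′) ⟩
    (Z u v ℤ.- Z u′ v′) ℤ.+ (Z u v ℤ.- Z u′ v′)  ≡⟨ Z-difference u v u′ v′ c≡ ⟩
    + q₁ ℤ.* (gap u v ℤ.- gap u′ v′)             ≡⟨ cong (+ q₁ ℤ.*_) gap≡ ⟩
    + q₁ ℤ.* (+ 0 ℤ.+ j ℤ.* + 2)                 ≡⟨ reorder (+ q₁) j ⟩
    j ℤ.* + q₁ ℤ.* + 2                           ∎))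
    where
    open ≡-Reasoning
    double : ∀ d → d ℤ.* + 2 ≡ d ℤ.+ d
    double = solve-∀
    reorder : ∀ Q j → Q ℤ.* (+ 0 ℤ.+ j ℤ.* + 2) ≡ j ℤ.* Q ℤ.* + 2
    reorder = solve-∀

  coincide⇒ : ∀ ψ u v u′ v′ → Is ψ u v → Is ψ u′ v′ → Coincide u v u′ v′
  coincide⇒ ψ u v u′ v′ is@(_ , _ , sym≡ , _) is′@(_ , _ , sym≡′ , _) =
    forcedDigits⇒Coincide u v u′ v′ same-digits (⊕≡0⇒≡ _ _ (parity-unique (gap-parity u v u′ v′) gap-even))
    where
    same-digits : ∀ i → forcedDigit u v i ≡ forcedDigit u′ v′ i
    same-digits i = trans (≡-sym (thetaSym≡lam⇒digit ψ u v i (sym≡ i))) (thetaSym≡lam⇒digit ψ u′ v′ i (sym≡′ i))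
    gap-even : Parity (gap u v ℤ.- gap u′ v′) zero
    gap-even = Z≡⇒gap-even u v u′ v′ (trans (≡-sym (Is⇒c≡ ψ u v is)) (Is⇒c≡ ψ u′ v′ is′))
      (Congℤ-trans {Z u v} {+ t[ ψ ]} {Z u′ v′} {q₁} (Congℤ-sym {+ t[ ψ ]} {Z u v} {q₁} (Is⇒t≡Z ψ u v is)) (Is⇒t≡Z ψ u′ v′ is′))

  coincide⇐ : ∀ ψ ψ′ u v u′ v′ → Is ψ u v → Is ψ′ u′ v′ → Coincide u v u′ v′ → ψ ≡ ψ′
  coincide⇐ ψ ψ′ u v u′ v′ is is′ coincide = ψ-injective c≡ t≡
    where
    same-c⟨⟩ : c⟨ u , v ⟩ ≡ c⟨ u′ , v′ ⟩
    same-c⟨⟩ = digits-injective m (c⟨⟩<q u v) (c⟨⟩<q u′ v′) λ i → ℤP.+-injective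
      (trans (digit-c⟨⟩ u v i) (trans (Coincide⇒forcedDigits u v u′ v′ coincide i) (≡-sym (digit-c⟨⟩ u′ v′ i))))
    c≡ : c[ ψ ] ≡ c[ ψ′ ]
    c≡ = trans (Is⇒c≡ ψ u v is) (trans same-c⟨⟩ (≡-sym (Is⇒c≡ ψ′ u′ v′ is′)))
    Z≡Z′ : Congℤ (Z u v) (Z u′ v′) q₁
    Z≡Z′ = gap-even⇒Z≡ u v u′ v′ same-c⟨⟩ (subst (Parity _) (≡⇒⊕≡0 _ _ (proj₁ coincide (lastI m))) (gap-parity u v u′ v′))
    t≡ : t[ ψ ] ≡ t[ ψ′ ]
    t≡ = Congℤ-bounded-≡ {t[ ψ ]} {t[ ψ′ ]}
           (Congℤ-trans {+ t[ ψ ]} {Z u v} {+ t[ ψ′ ]} {q₁} (Is⇒t≡Z ψ u v is)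
             (Congℤ-trans {Z u v} {Z u′ v′} {+ t[ ψ′ ]} {q₁} Z≡Z′
               (Congℤ-sym {+ t[ ψ′ ]} {Z u′ v′} {q₁} (Is⇒t≡Z ψ′ u′ v′ is′))))
           (t[]≥1 ψ (c[]<q ψ u v is)) (t[]≤q₁ ψ) (t[]≥1 ψ′ (c[]<q ψ′ u′ v′ is′)) (t[]≤q₁ ψ′)

  lam≡digitFor : ∀ v i → lam p m r v i ≡ digitFor (r i) (v i) (v (prev i)) zero
  lam≡digitFor v i with v i
  ... | zero     = eq (+ r i) (bit (v (prev i)))
    where eq : ∀ R X → R ℤ.+ X ≡ R ℤ.+ (X ℤ.+ + 0)
          eq = solve-∀
  ... | suc zero = eq (+ p) (+ r i) (bit (v (prev i)))
    where eq : ∀ P R X → P ℤ.- + 2 ℤ.- R ℤ.- X ≡ P ℤ.- + 2 ℤ.- R ℤ.+ (+ 0 ℤ.- X)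
          eq = solve-∀

  lam-bounds : ∀ v i → (+ 0 ℤ.≤ lam p m r v i) × (lam p m r v i ℤ.≤ + (p ∸ 1))
  lam-bounds v i = subst (λ l → (+ 0 ℤ.≤ l) × (l ℤ.≤ + (p ∸ 1))) (≡-sym as-nat)
                         (ℤ.+≤+ ℕ.z≤n , ℤ.+≤+ (ℕP.<⇒≤pred (digitForℕ-< (r i) (v i) (v (prev i)) zero (r+3≤p i))))
    where as-nat : lam p m r v i ≡ + digitForℕ (r i) (v i) (v (prev i)) zero
          as-nat = trans (lam≡digitFor v i) (≡-sym (digitForℕ-≡ (r i) (v i) (v (prev i)) zero (r+3≤p i)))

  Is-exists : ∀ u v → Σ (Char p m) λ ψ → Is ψ u v
  Is-exists u v = ψ , c≢q , bounds , sym≡ , det≡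
    where
    c = c⟨ u , v ⟩
    c<q : c < q
    c<q = c⟨⟩<q u v
    -- t is the representative of Z u v modulo q₁ in [1, q₁].
    z₁ : ℤ
    z₁ = Z u v ℤ.- + 1
    t : ℕ
    t = suc (z₁ ℤ.%ℕ q₁)
    t≡Z : Congℤ (+ t) (Z u v) q₁
    t≡Z = Congℤ-intro {+ t} {Z u v} (ℤ.- (z₁ ℤ./ℕ q₁) , (begin
      + t ℤ.- Z u v                                              ≡⟨ reorder (+ (z₁ ℤ.%ℕ q₁)) (Z u v) ⟩
      + (z₁ ℤ.%ℕ q₁) ℤ.- z₁                                      ≡⟨ cong (λ z → + (z₁ ℤ.%ℕ q₁) ℤ.- z) (ℤD.a≡a%ℕn+[a/ℕn]*n z₁ q₁) ⟩
      + (z₁ ℤ.%ℕ q₁) ℤ.- (+ (z₁ ℤ.%ℕ q₁) ℤ.+ (z₁ ℤ./ℕ q₁) ℤ.* + q₁) ≡⟨ cancel (+ (z₁ ℤ.%ℕ q₁)) (z₁ ℤ./ℕ q₁) (+ q₁) ⟩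
      ℤ.- (z₁ ℤ./ℕ q₁) ℤ.* + q₁                                  ∎))
      where
      open ≡-Reasoning
      reorder : ∀ r z → + 1 ℤ.+ r ℤ.- z ≡ r ℤ.- (z ℤ.- + 1)
      reorder = solve-∀
      cancel : ∀ r k Q → r ℤ.- (r ℤ.+ k ℤ.* Q) ≡ ℤ.- k ℤ.* Q
      cancel = solve-∀
    t≤q₁ : t ≤ q₁
    t≤q₁ = ℤD.n%ℕd<d z₁ q₁
    q≤c+t[q+1] : q ≤ c + t ℕ.* suc q
    q≤c+t[q+1] = ℕP.≤-trans (ℕP.n≤1+n q) (ℕP.≤-trans (ℕP.m≤m+n (suc q) _) (ℕP.m≤n+m (t ℕ.* suc q) c))
    n : ℕ
    n = c + t ℕ.* suc q ∸ q
    n+q : n + q ≡ c + t ℕ.* suc q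
    n+q = ℕP.m∸n+n≡m q≤c+t[q+1]
    n<q²-1 : n < q ℕ.* q ∸ 1
    n<q²-1 = ℕP.∸-monoˡ-≤ 1 (subst (λ Q → 2 + n ≤ Q ℕ.* Q) q₁+1≡q
      (split-bound q₁ c t n (ℕP.<⇒≤pred c<q) t≤q₁ (subst (λ Q → n + Q ≡ c + t ℕ.* suc Q) (≡-sym q₁+1≡q) n+q)))
      where q₁+1≡q : suc q₁ ≡ q
            q₁+1≡q = ℕP.suc-pred q {{ℕ.>-nonZero q≥1}}
    ψ : Char p m
    ψ = fromℕ< n<q²-1
    ψ+q : toℕ ψ + q ≡ c + t ℕ.* suc q
    ψ+q = trans (cong (_+ q) (FinP.toℕ-fromℕ< n<q²-1)) n+q
    c[ψ]≡c : c[ ψ ] ≡ c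
    c[ψ]≡c = trans (cong (ℕ._% suc q) ψ+q) (%-of-+* c t (suc q) (ℕP.m<n⇒m<1+n c<q))
    t[ψ]≡t : t[ ψ ] ≡ t
    t[ψ]≡t = trans (cong (ℕ._/ suc q) ψ+q) (/-of-+* c t (suc q) (ℕP.m<n⇒m<1+n c<q))
    c≢q : c[ ψ ] ≢ q
    c≢q c≡q = ℕP.<-irrefl (trans (≡-sym c[ψ]≡c) c≡q) c<q
    sym≡ : ∀ i → thetaSym p m (toℕ ψ) u i ≡ lam p m r v i
    sym≡ i = digit⇒thetaSym≡lam ψ u v i (trans (cong (λ c′ → + digit c′ i) c[ψ]≡c) (digit-c⟨⟩ u v i))
    bounds : ∀ i → (+ 0 ℤ.≤ thetaSym p m (toℕ ψ) u i) × (thetaSym p m (toℕ ψ) u i ℤ.≤ + (p ∸ 1))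
    bounds i = subst (λ l → (+ 0 ℤ.≤ l) × (l ℤ.≤ + (p ∸ 1))) (≡-sym (sym≡ i)) (lam-bounds v i)
    det≡ : Congℤ (thetaDet p m (toℕ ψ) u) (eLam p m r v) q₁
    det≡ = subst (λ d → + q₁ ∣ d) (≡-sym (thetaDet-minus-eLam ψ u v c[ψ]≡c sym≡))
                 (subst (λ t′ → Congℤ (+ t′) (Z u v) q₁) (≡-sym t[ψ]≡t) t≡Z)

prime≥3⇒odd : ∀ {p} → Prime p → 3 ≤ p → Parity (+ p) one
prime≥3⇒odd {p} p-prime 3≤p with parity-exists (+ p)
... | suc zero , odd    = odd
... | zero     , (k , e) = ⊥-elim (prime⇒¬composite p-prime
  (composite {2} 3≤p (ℤS.∣⇒∣ᵤ (ℤS.divides k (trans e (ℤP.+-identityˡ _))))))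

proposition3p11 :
  (p : ℕ) .{{_ : NonZero p}} → Prime p → (m : ℕ) →
  (r : Fin (suc m) → ℕ) →
  (∀ i → r i + 3 ≤ p) →
  ¬ (∀ i → r i ≡ 0) →
  ¬ (∀ i → r i + 3 ≡ p) →
  (∀ (v : Bin m) → ℓ v ≡ suc m → ∀ ψ → ¬ WDup p m r v ψ)
  × (∀ (v : Bin m) → ℓ v < suc m → HasSize (WDup p m r v) (2 ^ (suc m ∸ ℓ v)))
  × (∀ (v u : Bin m) (ψ : Char p m) → InU m v u → ThetaIs p m ψ u (sigma p m r v) →
       ∀ (u' v' : Bin m) → ThetaIs p m ψ u' (sigma p m r v') → v ≤ᵥ v')
  × (∀ (v v' : Bin m) (ψ : Char p m) → WDup p m r v ψ → WDup p m r v' ψ →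
       ∀ i → v i ≡ v' i)
  × (∀ (ψ : Char p m) →
       (WD p m r ψ → Σ (Bin m) λ v → WDup p m r v ψ)
       × ((Σ (Bin m) λ v → WDup p m r v ψ) → WD p m r ψ))
  × (∀ (v : Bin m) (ψ : Char p m) →
       (WDup p m r v ψ →
          WDdown p m r v ψ × (∀ (v' : Bin m) → v' <ᵥ v → ¬ WDdown p m r v' ψ))
       × (WDdown p m r v ψ × (∀ (v' : Bin m) → v' <ᵥ v → ¬ WDdown p m r v' ψ) →
          WDup p m r v ψ))
proposition3p11 p p-prime m r r+3≤p _ _ =
  Upper-full-empty , Upper-size , InU⇒≤ᵥ , Upper-disjoint , WD⇔⋃Upper , Upper⇔minimal
  where
  open Theta p (prime≥3⇒odd p-prime (ℕP.≤-trans (ℕP.m≤n+m 3 (r zero)) (r+3≤p zero))) m r r+3≤p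
  open Classification Is Is-exists coincide⇒ coincide⇐
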